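{- Let $q$ be a power of an odd prime and $r\ge 1$ an integer. Let $A\subseteq\mathbb F_q^r$ be a progression-free set, and let $\alpha:=q^{ -r}|A|$ be its density. Then there exist $g\in\mathbb F_q^r$ and a linear subspace $V<\mathbb F_q^r$ of co-dimension $1$ such that the density of $A$ on the affine subspace $g+V$ satisfies $$\frac{|A\cap(g+V)|}{|V|}\ \ge\ \frac{\alpha-q^{ -r}}{1-\alpha}.$$
   Context: A subset $A$ of an abelian group is called progression-free if for any $a,b,c\in A$ with $a+c=2b$ one has $a=c$. -}

module Defs where

open import Level using (0ℓ)
open import Data.Bool using (Bool; true; false; _∧_)
open import Data.Nat as ℕ using (ℕ; zero; suc)
open import Data.Fin using (Fin; zero; suc)
open import Data.List using (List; []; _∷_; length; filterᵇ; concatMap; map)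
open import Data.List.Membership.Propositional using (_∈_)
open import Data.List.Relation.Unary.Unique.Propositional using (Unique)
open import Data.Product using (∃; Σ; _×_; _,_)
open import Relation.Binary.PropositionalEquality using (_≡_; _≢_)
open import Relation.Binary.Definitions using (DecidableEquality)
open import Algebra.Structures using (IsCommutativeRing)

record FiniteField : Set₁ where
  infixl 6 _+_
  infixl 7 _*_
  field
    Carrier : Set
    _+_ _*_ : Carrier → Carrier → Carrier
    -_ : Carrier → Carrier
    0# 1# : Carrier
    isCommutativeRing : IsCommutativeRing _≡_ _+_ _*_ -_ 0# 1#
    0≢1 : 0# ≢ 1#
    inverse : ∀ x → x ≢ 0# → ∃ λ y → x * y ≡ 1#
    _≟_ : DecidableEquality Carrier
    elements : List Carrier
    elements-complete : ∀ x → x ∈ elements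
    elements-unique : Unique elements

  size : ℕ
  size = length elements

module _ (F : FiniteField) where
  open FiniteField F

  Vect : ℕ → Set
  Vect r = Fin r → Carrier

  _≐_ : ∀ {r} → Vect r → Vect r → Set
  u ≐ v = ∀ i → u i ≡ v i

  zeroV : ∀ {r} → Vect r
  zeroV _ = 0#

  _⊕_ : ∀ {r} → Vect r → Vect r → Vect r
  (u ⊕ v) i = u i + v i

  _⊖_ : ∀ {r} → Vect r → Vect r → Vect r
  (u ⊖ v) i = u i + (- v i)

  _⊙_ : ∀ {r} → Carrier → Vect r → Vect r
  (c ⊙ v) i = c * v i

  allVects : ∀ r → List (Vect r)
  allVects zero = (λ ()) ∷ []
  allVects (suc r) =
    concatMap (λ x → map (λ v → λ { zero → x ; (suc i) → v i }) (allVects r)) elements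

  Subset : ℕ → Set
  Subset r = Vect r → Bool

  card : ∀ {r} → Subset r → ℕ
  card {r} S = length (filterᵇ S (allVects r))

  _∩[_+_] : ∀ {r} → Subset r → Vect r → Subset r → Subset r
  (S ∩[ g + V ]) x = S x ∧ V (x ⊖ g)

  ProgressionFree : ∀ {r} → Subset r → Set
  ProgressionFree A = ∀ a b c → A a ≡ true → A b ≡ true → A c ≡ true →
    (a ⊕ c) ≐ (b ⊕ b) → a ≐ c

  record IsSubspace {r} (V : Subset r) : Set where
    field
      zero∈ : V zeroV ≡ true
      +-closed : ∀ u v → V u ≡ true → V v ≡ true → V (u ⊕ v) ≡ true
      ⊙-closed : ∀ c v → V v ≡ true → V (c ⊙ v) ≡ true

  sumF : ∀ {d} → (Fin d → Carrier) → Carrier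
  sumF {zero} f = 0#
  sumF {suc d} f = f zero + sumF (λ j → f (suc j))

  linComb : ∀ {r d} → (Fin d → Carrier) → (Fin d → Vect r) → Vect r
  linComb c b i = sumF (λ j → c j * b j i)

  record IsBasis {r d} (V : Subset r) (b : Fin d → Vect r) : Set where
    field
      in-V : ∀ j → V (b j) ≡ true
      independent : ∀ c → linComb c b ≐ zeroV → ∀ j → c j ≡ 0#
      spanning : ∀ v → V v ≡ true → Σ (Fin d → Carrier) λ c → v ≐ linComb c b

  HasDim : ∀ {r} → Subset r → ℕ → Set
  HasDim V d = IsSubspace V × Σ (Fin d → Vect _) (IsBasis V)

{-# OPTIONS --safe #-}
module Submission where

-- For a linear form w ≠ 0 and t ∈ F let a_w(t) = |A ∩ {x : w · x = t}|, a slice of A along a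
-- hyperplane.  Counting pairs and 3-term progressions in A through all w (the number of w with
-- w · v = 0 is q^(r-1), or q^r when v = 0) gives, with N = q^r and K = |A|,
--   q Σ_w Σ_t a_w(t)² = N K² + (q - 1) N K,
--   q Σ_w Σ_{s,t} a_w(s) a_w(t) a_w(2t - s) = N K³ + (q - 1) N K,
-- the second because A contains only its K trivial progressions.  If no slice reached the claimed
-- density, that is D a_w(t) < μ for all w ≠ 0 and t with μ = N (K - 1) and D = q (N - K), then the
-- weights μ - D a_w(t) ≥ 1 in
--   Σ_{s,t} (μ - D a_w(t)) (a_w(s) - a_w(2t - s))² ≥ Σ_{s,t} (a_w(s) - a_w(2t - s))²
-- turn these identities into -q (q - 1) K (N - K) ≥ 0, which is absurd for 0 < K < N (K = N is
-- excluded by progression-freeness, K = 0 is trivial).  So some slice, a coset of the hyperplane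
-- ker w, is dense enough.

open import Defs hiding (_⊕_; _⊖_; _⊙_; _≐_)
open import Algebra.Bundles using (CommutativeRing; CommutativeMonoid)
import Algebra.Properties.CommutativeSemigroup
import Algebra.Properties.Group
import Algebra.Properties.Ring
open import Algebra.Structures using (IsCommutativeRing)
open import Data.Bool using (Bool; true; false; _∧_)
open import Data.Empty using (⊥-elim)
open import Data.Fin using (Fin; zero; suc)
open import Data.Fin.Properties using (<-cmp; _<?_; ∀-cons-⇔)
open import Data.Integer as ℤ
  using (ℤ; +_; -[1+_]; +[1+_]; +0; 0ℤ; 1ℤ; ∣_∣; _+_; _-_; -_; _*_; +≤+; -≤+; +<+; nonNegative; positive)
import Data.Integer.Properties as ℤ
open import Data.Integer.Tactic.RingSolver using (solve-∀)
open import Data.List using (List; []; _∷_; length; lookup; filterᵇ; map; concatMap; _++_)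
open import Data.List.Membership.Propositional using (_∈_)
open import Data.List.Relation.Unary.All as All using (All; []; _∷_; tabulate)
open import Data.List.Relation.Unary.All.Properties using (¬Any⇒All¬)
open import Data.List.Relation.Unary.AllPairs using (AllPairs; []; _∷_)
open import Data.List.Relation.Unary.Any as Any using (here; there; index; any?)
open import Data.List.Relation.Unary.Any.Properties using (lookup-index)
open import Data.List.Relation.Unary.Unique.Propositional using (Unique)
open import Data.Nat as ℕ using (ℕ; zero; suc; _^_; _∸_; _≤_; z≤n; s≤s; nonTrivial⇒n>1)
import Data.Nat.Properties as ℕ
open import Data.Nat.Divisibility using (_∣_; divides; ∣1⇒≡1)
open import Data.Nat.Primality using (Prime; euclidsLemma; prime⇒irreducible; prime⇒nonTrivial; prime[2]; ¬prime[1])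
open import Data.Product using (Σ; Σ-syntax; _×_; _,_; proj₁; proj₂)
open import Data.Sum using (_⊎_; inj₁; inj₂)
open import Data.Vec.Functional using (head; tail)
open import Function using (_∘_; case_of_)
open import Function.Bundles using (mk⇔)
open import Relation.Binary.Definitions using (DecidableEquality; tri<; tri≈; tri>)
open import Relation.Binary.PropositionalEquality
open import Relation.Nullary using (Dec; yes; no; does; proof; ¬_; ¬?; contradiction)
import Relation.Nullary.Decidable as Dec
open import Relation.Nullary.Decidable using (dec-true; dec-false; does-⇔)
open import Relation.Nullary.Reflects using (Reflects; invert)

𝟙 : Bool → ℤ
𝟙 true = 1ℤ
𝟙 false = 0ℤ

𝟙-∧ : ∀ a b → 𝟙 (a ∧ b) ≡ 𝟙 a * 𝟙 b
𝟙-∧ true true = refl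
𝟙-∧ true false = refl
𝟙-∧ false b = refl

𝟙-idem : ∀ b → 𝟙 b * 𝟙 b ≡ 𝟙 b
𝟙-idem true = refl
𝟙-idem false = refl

0≤𝟙 : ∀ b → 0ℤ ℤ.≤ 𝟙 b
0≤𝟙 true = +≤+ z≤n
0≤𝟙 false = +≤+ z≤n

𝟙≤1 : ∀ b → 𝟙 b ℤ.≤ 1ℤ
𝟙≤1 true = +≤+ (s≤s z≤n)
𝟙≤1 false = +≤+ z≤n

0≤i*i : ∀ i → 0ℤ ℤ.≤ i * i
0≤i*i (+ n) = subst (0ℤ ℤ.≤_) (ℤ.pos-* n n) (+≤+ z≤n)
0≤i*i -[1+ n ] = +≤+ z≤n

𝟙+𝟙+𝟙-2≤𝟙*𝟙*𝟙 : ∀ a b c → 𝟙 a + 𝟙 b + 𝟙 c - + 2 ℤ.≤ 𝟙 a * 𝟙 b * 𝟙 c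
𝟙+𝟙+𝟙-2≤𝟙*𝟙*𝟙 true  true  true  = ℤ.≤-refl
𝟙+𝟙+𝟙-2≤𝟙*𝟙*𝟙 true  true  false = ℤ.≤-refl
𝟙+𝟙+𝟙-2≤𝟙*𝟙*𝟙 true  false true  = ℤ.≤-refl
𝟙+𝟙+𝟙-2≤𝟙*𝟙*𝟙 false true  true  = ℤ.≤-refl
𝟙+𝟙+𝟙-2≤𝟙*𝟙*𝟙 true  false false = -≤+
𝟙+𝟙+𝟙-2≤𝟙*𝟙*𝟙 false true  false = -≤+
𝟙+𝟙+𝟙-2≤𝟙*𝟙*𝟙 false false true  = -≤+
𝟙+𝟙+𝟙-2≤𝟙*𝟙*𝟙 false false false = -≤+

*-pos : ∀ {i j} → 0ℤ ℤ.< i → 0ℤ ℤ.< j → 0ℤ ℤ.< i * j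
*-pos {+[1+ m ]} {+[1+ n ]} _ _ = +<+ (s≤s z≤n)
*-pos {+0} (+<+ ()) _
*-pos {+[1+ m ]} {+0} _ (+<+ ())

i<j⇒0<j-i : ∀ {i j} → i ℤ.< j → 0ℤ ℤ.< j - i
i<j⇒0<j-i {i} {j} i<j = subst (ℤ._< j - i) (ℤ.+-inverseʳ i) (ℤ.+-monoˡ-< (- i) i<j)

i<j⇒1≤j-i : ∀ {i j} → i ℤ.< j → 1ℤ ℤ.≤ j - i
i<j⇒1≤j-i i<j = ℤ.i<j⇒suc[i]≤j (i<j⇒0<j-i i<j)

𝟙-guard : ∀ b {u v} → (b ≡ true → u ≡ v) → 𝟙 b * u ≡ 𝟙 b * v
𝟙-guard true u≡v = cong (1ℤ *_) (u≡v refl)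
𝟙-guard false u≡v = refl

module _ {X : Set} where

  ∑ : List X → (X → ℤ) → ℤ
  ∑ [] f = 0ℤ
  ∑ (x ∷ xs) f = f x + ∑ xs f

  syntax ∑ xs (λ x → e) = ∑[ x ← xs ] e

  ∑-cong : ∀ xs {f g : X → ℤ} → (∀ x → f x ≡ g x) → ∑ xs f ≡ ∑ xs g
  ∑-cong [] e = refl
  ∑-cong (x ∷ xs) e = cong₂ _+_ (e x) (∑-cong xs e)

  ∑-+ : ∀ xs (f g : X → ℤ) → ∑[ x ← xs ] (f x + g x) ≡ ∑ xs f + ∑ xs g
  ∑-+ [] f g = refl
  ∑-+ (x ∷ xs) f g = trans (cong (λ s → f x + g x + s) (∑-+ xs f g)) (interchange (f x) (g x) _ _)
    where
    interchange : ∀ a b c d → a + b + (c + d) ≡ a + c + (b + d)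
    interchange = solve-∀

  ∑-*ˡ : ∀ xs c (f : X → ℤ) → ∑[ x ← xs ] (c * f x) ≡ c * ∑ xs f
  ∑-*ˡ [] c f = sym (ℤ.*-zeroʳ c)
  ∑-*ˡ (x ∷ xs) c f = trans (cong (λ s → c * f x + s) (∑-*ˡ xs c f)) (sym (ℤ.*-distribˡ-+ c (f x) _))

  ∑-*ʳ : ∀ xs c (f : X → ℤ) → ∑[ x ← xs ] (f x * c) ≡ ∑ xs f * c
  ∑-*ʳ xs c f = trans (∑-cong xs λ x → ℤ.*-comm (f x) c) (trans (∑-*ˡ xs c f) (ℤ.*-comm c _))

  ∑-neg : ∀ xs (f : X → ℤ) → ∑[ x ← xs ] (- f x) ≡ - ∑ xs f
  ∑-neg [] f = refl
  ∑-neg (x ∷ xs) f = trans (cong (λ s → - f x + s) (∑-neg xs f)) (sym (ℤ.neg-distrib-+ (f x) _))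

  ∑-- : ∀ xs (f g : X → ℤ) → ∑[ x ← xs ] (f x - g x) ≡ ∑ xs f - ∑ xs g
  ∑-- xs f g = trans (∑-+ xs f (λ x → - g x)) (cong (λ s → ∑ xs f + s) (∑-neg xs g))

  ∑-const : ∀ xs c → ∑[ _ ← xs ] c ≡ + length xs * c
  ∑-const [] c = refl
  ∑-const (x ∷ xs) c = trans (cong (λ s → c + s) (∑-const xs c)) (c+nc (+ length xs) c)
    where
    c+nc : ∀ n c → c + n * c ≡ (1ℤ + n) * c
    c+nc = solve-∀

  ∑-mono-All : ∀ xs {f g : X → ℤ} → All (λ x → f x ℤ.≤ g x) xs → ∑ xs f ℤ.≤ ∑ xs g
  ∑-mono-All [] [] = ℤ.≤-refl
  ∑-mono-All (x ∷ xs) (f≤g ∷ fs≤gs) = ℤ.+-mono-≤ f≤g (∑-mono-All xs fs≤gs)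

  ∑-mono : ∀ xs {f g : X → ℤ} → (∀ x → f x ℤ.≤ g x) → ∑ xs f ℤ.≤ ∑ xs g
  ∑-mono xs f≤g = ∑-mono-All xs (tabulate λ {x} _ → f≤g x)

  ∑-nonneg : ∀ xs {f : X → ℤ} → (∀ x → 0ℤ ℤ.≤ f x) → 0ℤ ℤ.≤ ∑ xs f
  ∑-nonneg [] 0≤f = ℤ.≤-refl
  ∑-nonneg (x ∷ xs) 0≤f = ℤ.+-mono-≤ (0≤f x) (∑-nonneg xs 0≤f)

  ∑-++ : ∀ xs ys (f : X → ℤ) → ∑ (xs ++ ys) f ≡ ∑ xs f + ∑ ys f
  ∑-++ [] ys f = sym (ℤ.+-identityˡ _)
  ∑-++ (x ∷ xs) ys f = trans (cong (λ s → f x + s) (∑-++ xs ys f)) (sym (ℤ.+-assoc (f x) _ _))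

  ∑-𝟙 : ∀ (P : X → Bool) xs → + length (filterᵇ P xs) ≡ ∑[ x ← xs ] 𝟙 (P x)
  ∑-𝟙 P [] = refl
  ∑-𝟙 P (x ∷ xs) with P x
  ... | true = cong (λ s → 1ℤ + s) (∑-𝟙 P xs)
  ... | false = trans (∑-𝟙 P xs) (sym (ℤ.+-identityˡ _))

module _ {X Y : Set} where

  ∑-swap : ∀ xs ys (f : X → Y → ℤ) → ∑[ x ← xs ] ∑ ys (f x) ≡ ∑[ y ← ys ] ∑[ x ← xs ] f x y
  ∑-swap [] ys f = sym (trans (∑-const ys 0ℤ) (ℤ.*-zeroʳ (+ length ys)))
  ∑-swap (x ∷ xs) ys f =
    trans (cong (λ s → ∑ ys (f x) + s) (∑-swap xs ys f)) (sym (∑-+ ys (f x) _))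

  ∑-map : ∀ (g : X → Y) xs (f : Y → ℤ) → ∑ (map g xs) f ≡ ∑[ x ← xs ] f (g x)
  ∑-map g [] f = refl
  ∑-map g (x ∷ xs) f = cong (λ s → f (g x) + s) (∑-map g xs f)

∑-concatMap : ∀ {X Y Z : Set} (g : X → Y → Z) xs ys (f : Z → ℤ) →
  ∑ (concatMap (λ x → map (g x) ys) xs) f ≡ ∑[ x ← xs ] ∑[ y ← ys ] f (g x y)
∑-concatMap g [] ys f = refl
∑-concatMap g (x ∷ xs) ys f =
  trans (∑-++ (map (g x) ys) _ f) (cong₂ _+_ (∑-map (g x) ys f) (∑-concatMap g xs ys f))

module _ {X Y : Set} where

  ∑∑-+ : ∀ xs ys (f g : X → Y → ℤ) →
    ∑[ x ← xs ] ∑[ y ← ys ] (f x y + g x y) ≡ ∑[ x ← xs ] ∑ ys (f x) + ∑[ x ← xs ] ∑ ys (g x)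
  ∑∑-+ xs ys f g = trans (∑-cong xs λ x → ∑-+ ys (f x) (g x)) (∑-+ xs _ _)

  ∑∑-*ˡ : ∀ xs ys c (f : X → Y → ℤ) → ∑[ x ← xs ] ∑[ y ← ys ] (c * f x y) ≡ c * ∑[ x ← xs ] ∑ ys (f x)
  ∑∑-*ˡ xs ys c f = trans (∑-cong xs λ x → ∑-*ˡ ys c (f x)) (∑-*ˡ xs c _)

  infixr 6 _⊗_
  _⊗_ : List X → List Y → List (X × Y)
  xs ⊗ ys = concatMap (λ x → map (x ,_) ys) xs

  ∑-⊗ : ∀ xs ys (f : X × Y → ℤ) → ∑ (xs ⊗ ys) f ≡ ∑[ x ← xs ] ∑[ y ← ys ] f (x , y)
  ∑-⊗ = ∑-concatMap _,_

𝟙-<-total : ∀ {n} {i j : Fin n} → i ≢ j → 𝟙 (does (i <? j)) + 𝟙 (does (j <? i)) ≡ 1ℤ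
𝟙-<-total {i = i} {j} i≢j with <-cmp i j
... | tri< i<j _ j≮i rewrite dec-true (i <? j) i<j | dec-false (j <? i) j≮i = refl
... | tri≈ _ i≡j _ = contradiction i≡j i≢j
... | tri> i≮j _ j<i rewrite dec-false (i <? j) i≮j | dec-true (j <? i) j<i = refl

module Enumeration {X : Set} (_≟_ : DecidableEquality X)
  (xs : List X) (complete : ∀ x → x ∈ xs) (unique : Unique xs) where

  δ : X → X → ℤ
  δ x y = 𝟙 (does (x ≟ y))

  δ-comm : ∀ x y → δ x y ≡ δ y x
  δ-comm x y = cong 𝟙 (does-⇔ (mk⇔ sym sym) (x ≟ y) (y ≟ x))

  δ-refl : ∀ x → δ x x ≡ 1ℤ
  δ-refl x = cong 𝟙 (dec-true (x ≟ x) refl)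

  δ-idem : ∀ x y → δ x y * δ x y ≡ δ x y
  δ-idem x y = 𝟙-idem (does (x ≟ y))

  δ-≢ : ∀ {x y} → x ≢ y → δ x y ≡ 0ℤ
  δ-≢ {x} {y} x≢y = cong 𝟙 (dec-false (x ≟ y) x≢y)

  ∑-δ : ∀ c (f : X → ℤ) → ∑[ x ← xs ] (δ x c * f x) ≡ f c
  ∑-δ c f = go xs unique (complete c)
    where
    off : ∀ ys → All (c ≢_) ys → ∑[ x ← ys ] (δ x c * f x) ≡ 0ℤ
    off [] [] = refl
    off (y ∷ ys) (c≢y ∷ c∉ys) rewrite δ-≢ (λ y≡c → c≢y (sym y≡c)) =
      trans (ℤ.+-identityˡ _) (off ys c∉ys)
    go : ∀ ys → AllPairs _≢_ ys → c ∈ ys → ∑[ x ← ys ] (δ x c * f x) ≡ f c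
    go (y ∷ ys) (y∉ys ∷ _) (here refl) rewrite δ-refl y | off ys y∉ys =
      trans (ℤ.+-identityʳ _) (ℤ.*-identityˡ _)
    go (y ∷ ys) (y∉ys ∷ distinct) (there c∈ys) rewrite δ-≢ (All.lookup y∉ys c∈ys) =
      trans (ℤ.+-identityˡ _) (go ys distinct c∈ys)

  ∑-δ′ : ∀ c (f : X → ℤ) → ∑[ x ← xs ] (δ c x * f x) ≡ f c
  ∑-δ′ c f = trans (∑-cong xs λ x → cong (_* f x) (δ-comm c x)) (∑-δ c f)

  ∑-reindex : (σ τ : X → X) → (∀ y → σ (τ y) ≡ y) → (∀ x → τ (σ x) ≡ x) →
    (f : X → ℤ) → ∑[ x ← xs ] f (σ x) ≡ ∑ xs f
  ∑-reindex σ τ στ τσ f = begin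
    ∑[ x ← xs ] f (σ x)                          ≡⟨ ∑-cong xs (λ x → ∑-δ (σ x) f) ⟨
    ∑[ x ← xs ] ∑[ y ← xs ] (δ y (σ x) * f y)   ≡⟨ ∑-swap xs xs _ ⟩
    ∑[ y ← xs ] ∑[ x ← xs ] (δ y (σ x) * f y)   ≡⟨ ∑-cong xs (λ y → ∑-cong xs λ x → cong (_* f y) (moved y x)) ⟩
    ∑[ y ← xs ] ∑[ x ← xs ] (δ x (τ y) * f y)   ≡⟨ ∑-cong xs (λ y → ∑-δ (τ y) (λ _ → f y)) ⟩
    ∑ xs f                                       ∎
    where
    open ≡-Reasoning
    moved : ∀ y x → δ y (σ x) ≡ δ x (τ y)
    moved y x = cong 𝟙 (does-⇔ (mk⇔ (λ y≡σx → trans (sym (τσ x)) (cong τ (sym y≡σx)))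
                                    (λ x≡τy → trans (sym (στ y)) (cong σ (sym x≡τy))))
                               (y ≟ σ x) (x ≟ τ y))

  -- Each orbit {x, σ x} has exactly one element listed before its partner.
  involution⇒even : (σ : X → X) → (∀ x → σ (σ x) ≡ x) → (∀ x → σ x ≢ x) → 2 ∣ length xs
  involution⇒even σ σσ σ≢id = divides ∣ R ∣ (ℤ.+-injective (begin
    + length xs                        ≡⟨ R+R ⟨
    R + R                              ≡⟨ cong₂ _+_ +∣R∣ +∣R∣ ⟨
    + (∣ R ∣ ℕ.+ ∣ R ∣)                ≡⟨ cong +_ (trans (cong (∣ R ∣ ℕ.+_) (sym (ℕ.+-identityʳ _)))
                                                        (ℕ.*-comm 2 ∣ R ∣)) ⟩
    + (∣ R ∣ ℕ.* 2)                    ∎))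
    where
    open ≡-Reasoning
    pos : X → Fin (length xs)
    pos x = index (complete x)

    pos-injective : ∀ {x y} → pos x ≡ pos y → x ≡ y
    pos-injective {x} {y} eq =
      trans (lookup-index (complete x)) (trans (cong (lookup xs) eq) (sym (lookup-index (complete y))))

    before : X → Bool
    before x = does (pos x <? pos (σ x))

    orbit : ∀ x → 𝟙 (before x) + 𝟙 (before (σ x)) ≡ 1ℤ
    orbit x = trans (cong (λ y → 𝟙 (before x) + 𝟙 (does (pos (σ x) <? pos y))) (σσ x))
                    (𝟙-<-total (λ eq → σ≢id x (sym (pos-injective eq))))

    R : ℤ
    R = ∑[ x ← xs ] 𝟙 (before x)

    R+R : R + R ≡ + length xs
    R+R = begin
      R + R                                       ≡⟨ cong (λ s → R + s) (∑-reindex σ σ σσ σσ (λ x → 𝟙 (before x))) ⟨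
      R + ∑[ x ← xs ] 𝟙 (before (σ x))             ≡⟨ ∑-+ xs _ _ ⟨
      ∑[ x ← xs ] (𝟙 (before x) + 𝟙 (before (σ x))) ≡⟨ ∑-cong xs orbit ⟩
      ∑[ x ← xs ] 1ℤ                              ≡⟨ ∑-const xs 1ℤ ⟩
      + length xs * 1ℤ                            ≡⟨ ℤ.*-identityʳ _ ⟩
      + length xs                                 ∎

    +∣R∣ : + ∣ R ∣ ≡ R
    +∣R∣ = ℤ.0≤i⇒+∣i∣≡i (∑-nonneg xs λ x → 0≤𝟙 (before x))

prime∣prime^⇒≡ : ∀ {d p} k → Prime d → Prime p → d ∣ p ^ k → d ≡ p
prime∣prime^⇒≡ zero pd _ d∣1 = contradiction (subst Prime (∣1⇒≡1 d∣1) pd) ¬prime[1]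
prime∣prime^⇒≡ {p = p} (suc k) pd pp d∣p^[1+k] with euclidsLemma p (p ^ k) pd d∣p^[1+k]
... | inj₂ d∣p^k = prime∣prime^⇒≡ k pd pp d∣p^k
... | inj₁ d∣p with prime⇒irreducible pp d∣p
...   | inj₁ d≡1 = contradiction (subst Prime d≡1 pd) ¬prime[1]
...   | inj₂ d≡p = d≡p

1<m^[1+n] : ∀ {m} n → 1 ℕ.< m → 1 ℕ.< m ^ suc n
1<m^[1+n] {m} n 1<m = ℕ.<-≤-trans 1<m
  (subst (_≤ m ^ suc n) (ℕ.*-identityʳ m) (ℕ.^-monoʳ-≤ m {{ℕ.>-nonZero (ℕ.<-trans ℕ.z<s 1<m)}} {1} {suc n} (s≤s z≤n)))

module _ (F : FiniteField) where

  open FiniteField F renaming (_+_ to _+F_; _*_ to _*F_; -_ to -F_)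
  open Enumeration _≟_ elements elements-complete elements-unique

  q : ℕ
  q = size

  module R = IsCommutativeRing isCommutativeRing

  fieldRing : CommutativeRing _ _
  fieldRing = record { isCommutativeRing = isCommutativeRing }

  module +G = Algebra.Properties.Group (CommutativeRing.+-group fieldRing)
  module RP = Algebra.Properties.Ring (CommutativeRing.ring fieldRing)
  module +S = Algebra.Properties.CommutativeSemigroup
    (CommutativeMonoid.commutativeSemigroup (CommutativeRing.+-commutativeMonoid fieldRing))
  module *S = Algebra.Properties.CommutativeSemigroup
    (CommutativeMonoid.commutativeSemigroup (CommutativeRing.*-commutativeMonoid fieldRing))

  infixl 6 _-F_
  _-F_ : Carrier → Carrier → Carrier
  a -F b = a +F -F b

  sub-add : ∀ a b → a -F b +F b ≡ a
  sub-add a b = +G.//-rightDividesˡ b a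

  add-sub : ∀ a b → a +F b -F b ≡ a
  add-sub a b = +G.//-rightDividesʳ b a

  δ-sub : ∀ a b → δ a b ≡ δ (a -F b) 0#
  δ-sub a b = cong 𝟙 (does-⇔ (mk⇔ +G.x≈y⇒x∙y⁻¹≈ε (+G.x∙y⁻¹≈ε⇒x≈y a b)) (a ≟ b) ((a -F b) ≟ 0#))

  δ-add : ∀ a b c → δ a (c -F b) ≡ δ (a +F b) c
  δ-add a b c = cong 𝟙 (does-⇔ (mk⇔ (λ a≡c-b → trans (cong (_+F b) a≡c-b) (sub-add c b))
                                        (λ a+b≡c → trans (sym (add-sub a b)) (cong (_-F b) a+b≡c)))
                                   (a ≟ (c -F b)) ((a +F b) ≟ c))

  inv : ∀ x → x ≢ 0# → Carrier
  inv x x≢0 = proj₁ (inverse x x≢0)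

  *-inverseʳ : ∀ x (x≢0 : x ≢ 0#) → x *F inv x x≢0 ≡ 1#
  *-inverseʳ x x≢0 = proj₂ (inverse x x≢0)

  *-inverseˡ : ∀ x (x≢0 : x ≢ 0#) → inv x x≢0 *F x ≡ 1#
  *-inverseˡ x x≢0 = trans (R.*-comm _ x) (*-inverseʳ x x≢0)

  *-cancel-inverse : ∀ a x (x≢0 : x ≢ 0#) → a *F x *F inv x x≢0 ≡ a
  *-cancel-inverse a x x≢0 = begin
    a *F x *F inv x x≢0     ≡⟨ R.*-assoc a x _ ⟩
    a *F (x *F inv x x≢0)   ≡⟨ cong (a *F_) (*-inverseʳ x x≢0) ⟩
    a *F 1#                 ≡⟨ R.*-identityʳ a ⟩
    a                       ∎
    where open ≡-Reasoning

  *-inverse-cancel : ∀ a x (x≢0 : x ≢ 0#) → a *F inv x x≢0 *F x ≡ a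
  *-inverse-cancel a x x≢0 = begin
    a *F inv x x≢0 *F x     ≡⟨ R.*-assoc a _ x ⟩
    a *F (inv x x≢0 *F x)   ≡⟨ cong (a *F_) (*-inverseˡ x x≢0) ⟩
    a *F 1#                 ≡⟨ R.*-identityʳ a ⟩
    a                       ∎
    where open ≡-Reasoning

  -- If 1 + 1 = 0, then x ↦ x + 1 pairs off the elements of F, so 2 ∣ q.
  prime-power-odd⇒1+1≢0 : ∀ p k → Prime p → p ≢ 2 → q ≡ p ^ k → 1# +F 1# ≢ 0#
  prime-power-odd⇒1+1≢0 p k p-prime p≢2 q≡p^k 1+1≡0 =
    p≢2 (sym (prime∣prime^⇒≡ k prime[2] p-prime (subst (2 ∣_) q≡p^k (involution⇒even σ σσ σ≢id))))
    where
    σ : Carrier → Carrier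
    σ x = x +F 1#
    σσ : ∀ x → σ (σ x) ≡ x
    σσ x = trans (R.+-assoc x 1# 1#) (trans (cong (x +F_) 1+1≡0) (R.+-identityʳ x))
    σ≢id : ∀ x → σ x ≢ x
    σ≢id x x+1≡x = 0≢1 (sym (+G.identityʳ-unique x 1# x+1≡x))

  module Halving (1+1≢0 : 1# +F 1# ≢ 0#) where

    half : Carrier
    half = inv (1# +F 1#) 1+1≢0

    private
      x+x≡x*2 : ∀ x → x +F x ≡ x *F (1# +F 1#)
      x+x≡x*2 x = sym (trans (R.distribˡ x 1# 1#) (cong₂ _+F_ (R.*-identityʳ x) (R.*-identityʳ x)))

    half+half : ∀ x → x *F half +F x *F half ≡ x
    half+half x = trans (x+x≡x*2 (x *F half)) (*-inverse-cancel x _ 1+1≢0)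

    double-half : ∀ x → (x +F x) *F half ≡ x
    double-half x = trans (cong (_*F half) (x+x≡x*2 x)) (*-cancel-inverse x _ 1+1≢0)

    +-halve : ∀ {x y} → x +F x ≡ y +F y → x ≡ y
    +-halve {x} {y} eq = trans (sym (double-half x)) (trans (cong (_*F half) eq) (double-half y))

  ∑-δ-affine : ∀ v (v≢0 : v ≢ 0#) d c → ∑[ a ← elements ] δ (a *F v +F d) c ≡ 1ℤ
  ∑-δ-affine v v≢0 d c =
    trans (∑-reindex σ τ στ τσ (λ y → δ y c)) (trans (∑-cong elements λ y → sym (ℤ.*-identityʳ _)) (∑-δ c (λ _ → 1ℤ)))
    where
    σ τ : Carrier → Carrier
    σ a = a *F v +F d
    τ y = (y -F d) *F inv v v≢0
    στ : ∀ y → σ (τ y) ≡ y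
    στ y = trans (cong (_+F d) (*-inverse-cancel (y -F d) v v≢0)) (sub-add y d)
    τσ : ∀ a → τ (σ a) ≡ a
    τσ a = trans (cong (_*F inv v v≢0) (add-sub (a *F v) d)) (*-cancel-inverse a v v≢0)

  infixl 6 _⊕_ _⊖_
  infix 4 _≐_

  _⊕_ _⊖_ : ∀ {r} → Vect F r → Vect F r → Vect F r
  _⊕_ = Defs._⊕_ F
  _⊖_ = Defs._⊖_ F

  _⊙_ : ∀ {r} → Carrier → Vect F r → Vect F r
  _⊙_ = Defs._⊙_ F

  0ᵥ : ∀ {r} → Vect F r
  0ᵥ = Defs.zeroV F

  _≐_ : ∀ {r} → Vect F r → Vect F r → Set
  _≐_ = Defs._≐_ F

  _≐?_ : ∀ {r} (u v : Vect F r) → Dec (u ≐ v)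
  _≐?_ {zero} u v = yes λ ()
  _≐?_ {suc r} u v = Dec.map ∀-cons-⇔ ((head u ≟ head v) Dec.×-dec (tail u ≐? tail v))

  δᵥ : ∀ {r} → Vect F r → Vect F r → ℤ
  δᵥ u v = 𝟙 (does (u ≐? v))

  δᵥ-suc : ∀ {r} (u v : Vect F (suc r)) → δᵥ u v ≡ δ (head u) (head v) * δᵥ (tail u) (tail v)
  δᵥ-suc u v = 𝟙-∧ (does (head u ≟ head v)) (does (tail u ≐? tail v))

  vectors : ∀ r → List (Vect F r)
  vectors = allVects F

  N M : ℕ → ℤ
  N r = + (q ^ r)
  M r = N (suc r) - N r

  N-suc : ∀ r → N (suc r) ≡ + q * N r
  N-suc r = ℤ.pos-* q (q ^ r)

  M-suc : ∀ r → M (suc r) ≡ + q * M r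
  M-suc r = trans (cong₂ _-_ (N-suc (suc r)) (N-suc r)) (distrib (+ q) (N (suc r)) (N r))
    where
    distrib : ∀ a b c → a * b - a * c ≡ a * (b - c)
    distrib = solve-∀

  private
    vectors-suc : ∀ r → Σ[ ext ∈ (Carrier → Vect F r → Vect F (suc r)) ]
      vectors (suc r) ≡ concatMap (λ x → map (ext x) (vectors r)) elements
    vectors-suc r = _ , refl

  -- allVects extends vectors by a pattern lambda; naming it is what lets sums over F^(1+r) be split.
  infixr 5 _∷ᵥ_
  _∷ᵥ_ : ∀ {r} → Carrier → Vect F r → Vect F (suc r)
  _∷ᵥ_ {r} = proj₁ (vectors-suc r)

  ∑ᵥ-suc : ∀ r (f : Vect F (suc r) → ℤ) →
    ∑ (vectors (suc r)) f ≡ ∑[ x ← elements ] ∑[ v ← vectors r ] f (x ∷ᵥ v)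
  ∑ᵥ-suc r f = ∑-concatMap _∷ᵥ_ elements (vectors r) f

  ∑ᵥ-const : ∀ r c → ∑[ _ ← vectors r ] c ≡ N r * c
  ∑ᵥ-const zero c = trans (ℤ.+-identityʳ c) (sym (ℤ.*-identityˡ c))
  ∑ᵥ-const (suc r) c = begin
    ∑[ _ ← vectors (suc r) ] c               ≡⟨ ∑ᵥ-suc r (λ _ → c) ⟩
    ∑[ _ ← elements ] ∑[ _ ← vectors r ] c   ≡⟨ ∑-cong elements (λ _ → ∑ᵥ-const r c) ⟩
    ∑[ _ ← elements ] (N r * c)              ≡⟨ ∑-const elements _ ⟩
    + q * (N r * c)                          ≡⟨ ℤ.*-assoc (+ q) (N r) c ⟨
    + q * N r * c                            ≡⟨ cong (_* c) (N-suc r) ⟨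
    N (suc r) * c                            ∎
    where open ≡-Reasoning

  ∑-δᵥ : ∀ r (c : Vect F r) → ∑[ v ← vectors r ] δᵥ v c ≡ 1ℤ
  ∑-δᵥ zero c = refl
  ∑-δᵥ (suc r) c = begin
    ∑[ v ← vectors (suc r) ] δᵥ v c
      ≡⟨ ∑ᵥ-suc r _ ⟩
    ∑[ x ← elements ] ∑[ v ← vectors r ] δᵥ (x ∷ᵥ v) c
      ≡⟨ ∑-cong elements split ⟩
    ∑[ x ← elements ] (δ x (head c) * ∑[ v ← vectors r ] δᵥ v (tail c))
      ≡⟨ ∑-cong elements (λ x → cong (δ x (head c) *_) (∑-δᵥ r (tail c))) ⟩
    ∑[ x ← elements ] (δ x (head c) * 1ℤ)
      ≡⟨ ∑-δ (head c) (λ _ → 1ℤ) ⟩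
    1ℤ
      ∎
    where
    open ≡-Reasoning
    split : ∀ x → ∑[ v ← vectors r ] δᵥ (x ∷ᵥ v) c ≡ δ x (head c) * ∑[ v ← vectors r ] δᵥ v (tail c)
    split x = trans (∑-cong (vectors r) λ v → δᵥ-suc (x ∷ᵥ v) c)
                    (∑-*ˡ (vectors r) (δ x (head c)) (λ v → δᵥ v (tail c)))

  -- Stated for all h: as vectors are functions, a subset of F^r need not respect ≐, so there is no
  -- useful ∑ᵥ δᵥ v c * f v ≡ f c.
  ∑ᵥ-diagonal : ∀ r (h : Vect F r → Vect F r → ℤ) →
    ∑[ x ← vectors r ] ∑[ y ← vectors r ] (δᵥ x y * h x y) ≡ ∑[ x ← vectors r ] h x x
  ∑ᵥ-diagonal zero h = singleton _
    where
    singleton : ∀ e → ∑[ x ← e ∷ [] ] ∑[ y ← e ∷ [] ] (δᵥ x y * h x y) ≡ ∑[ x ← e ∷ [] ] h x x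
    singleton e = cong (_+ 0ℤ) (trans (ℤ.+-identityʳ (1ℤ * h e e)) (ℤ.*-identityˡ (h e e)))
  ∑ᵥ-diagonal (suc r) h = begin
    ∑[ x ← vectors (suc r) ] ∑[ y ← vectors (suc r) ] (δᵥ x y * h x y)
      ≡⟨ ∑ᵥ-suc r _ ⟩
    ∑[ a ← elements ] ∑[ x ← vectors r ] ∑[ y ← vectors (suc r) ] (δᵥ (a ∷ᵥ x) y * h (a ∷ᵥ x) y)
      ≡⟨ ∑-cong elements (λ a → ∑-cong (vectors r) λ x → inner a x) ⟩
    ∑[ a ← elements ] ∑[ x ← vectors r ] ∑[ y ← vectors r ] (δᵥ x y * h (a ∷ᵥ x) (a ∷ᵥ y))
      ≡⟨ ∑-cong elements (λ a → ∑ᵥ-diagonal r (λ x y → h (a ∷ᵥ x) (a ∷ᵥ y))) ⟩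
    ∑[ a ← elements ] ∑[ x ← vectors r ] h (a ∷ᵥ x) (a ∷ᵥ x)
      ≡⟨ ∑ᵥ-suc r (λ x → h x x) ⟨
    ∑[ x ← vectors (suc r) ] h x x
      ∎
    where
    open ≡-Reasoning
    inner : ∀ a x → ∑[ y ← vectors (suc r) ] (δᵥ (a ∷ᵥ x) y * h (a ∷ᵥ x) y)
                  ≡ ∑[ y ← vectors r ] (δᵥ x y * h (a ∷ᵥ x) (a ∷ᵥ y))
    inner a x = begin
      ∑[ y ← vectors (suc r) ] (δᵥ (a ∷ᵥ x) y * h (a ∷ᵥ x) y)
        ≡⟨ ∑ᵥ-suc r _ ⟩
      ∑[ b ← elements ] ∑[ y ← vectors r ] (δᵥ (a ∷ᵥ x) (b ∷ᵥ y) * h (a ∷ᵥ x) (b ∷ᵥ y))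
        ≡⟨ ∑-cong elements (λ b → ∑-cong (vectors r) λ y →
             cong (_* h (a ∷ᵥ x) (b ∷ᵥ y)) (δᵥ-suc (a ∷ᵥ x) (b ∷ᵥ y))) ⟩
      ∑[ b ← elements ] ∑[ y ← vectors r ] (δ a b * δᵥ x y * h (a ∷ᵥ x) (b ∷ᵥ y))
        ≡⟨ ∑-cong elements (λ b → trans (∑-cong (vectors r) λ y → ℤ.*-assoc (δ a b) _ _)
                                         (∑-*ˡ (vectors r) (δ a b) _)) ⟩
      ∑[ b ← elements ] (δ a b * ∑[ y ← vectors r ] (δᵥ x y * h (a ∷ᵥ x) (b ∷ᵥ y)))
        ≡⟨ ∑-δ′ a _ ⟩
      ∑[ y ← vectors r ] (δᵥ x y * h (a ∷ᵥ x) (a ∷ᵥ y))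
        ∎

  sumF-cong : ∀ {d} {f g : Fin d → Carrier} → (∀ i → f i ≡ g i) → sumF F f ≡ sumF F g
  sumF-cong {zero} f≗g = refl
  sumF-cong {suc d} f≗g = cong₂ _+F_ (f≗g zero) (sumF-cong (f≗g ∘ suc))

  sumF-+ : ∀ {d} (f g : Fin d → Carrier) → sumF F (λ i → f i +F g i) ≡ sumF F f +F sumF F g
  sumF-+ {zero} f g = sym (R.+-identityʳ 0#)
  sumF-+ {suc d} f g =
    trans (cong (f zero +F g zero +F_) (sumF-+ (f ∘ suc) (g ∘ suc))) (+S.interchange (f zero) (g zero) _ _)

  sumF-*ˡ : ∀ {d} c (f : Fin d → Carrier) → sumF F (λ i → c *F f i) ≡ c *F sumF F f
  sumF-*ˡ {zero} c f = sym (R.zeroʳ c)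
  sumF-*ˡ {suc d} c f = trans (cong (c *F f zero +F_) (sumF-*ˡ c (f ∘ suc))) (sym (R.distribˡ c _ _))

  sumF-zero : ∀ {d} (f : Fin d → Carrier) → (∀ i → f i ≡ 0#) → sumF F f ≡ 0#
  sumF-zero {zero} f f≗0 = refl
  sumF-zero {suc d} f f≗0 = trans (cong₂ _+F_ (f≗0 zero) (sumF-zero (f ∘ suc) (f≗0 ∘ suc))) (R.+-identityʳ 0#)

  sumF-neg : ∀ {d} (f : Fin d → Carrier) → sumF F (λ i → -F f i) ≡ -F sumF F f
  sumF-neg f = trans (sumF-cong (λ i → sym (RP.-1*x≈-x (f i)))) (trans (sumF-*ˡ (-F 1#) f) (RP.-1*x≈-x _))

  infix 21 _·_
  _·_ : ∀ {r} → Vect F r → Vect F r → Carrier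
  w · v = sumF F (λ i → w i *F v i)

  ·-comm : ∀ {r} (w v : Vect F r) → w · v ≡ v · w
  ·-comm w v = sumF-cong (λ i → R.*-comm (w i) (v i))

  ·-⊕ʳ : ∀ {r} (w u v : Vect F r) → w · (u ⊕ v) ≡ w · u +F w · v
  ·-⊕ʳ w u v = trans (sumF-cong (λ i → R.distribˡ (w i) (u i) (v i))) (sumF-+ (λ i → w i *F u i) (λ i → w i *F v i))

  ·-⊖ʳ : ∀ {r} (w u v : Vect F r) → w · (u ⊖ v) ≡ w · u -F w · v
  ·-⊖ʳ w u v = begin
    w · (u ⊖ v)                                     ≡⟨ sumF-cong (λ i → R.distribˡ (w i) (u i) (-F v i)) ⟩
    sumF F (λ i → w i *F u i +F w i *F -F v i)      ≡⟨ sumF-+ (λ i → w i *F u i) (λ i → w i *F -F v i) ⟩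
    w · u +F sumF F (λ i → w i *F -F v i)           ≡⟨ cong (w · u +F_) (sumF-cong λ i → RP.-‿distribʳ-* (w i) (v i)) ⟨
    w · u +F sumF F (λ i → -F (w i *F v i))         ≡⟨ cong (w · u +F_) (sumF-neg (λ i → w i *F v i)) ⟩
    w · u -F w · v                                  ∎
    where open ≡-Reasoning

  ·-⊙ʳ : ∀ {r} (w : Vect F r) c v → w · (c ⊙ v) ≡ c *F w · v
  ·-⊙ʳ w c v = trans (sumF-cong (λ i → *S.x∙yz≈y∙xz (w i) c (v i))) (sumF-*ˡ c (λ i → w i *F v i))

  ·-zeroˡ : ∀ {r} (w v : Vect F r) → w ≐ 0ᵥ → w · v ≡ 0#
  ·-zeroˡ w v w≐0 = sumF-zero _ (λ i → trans (cong (_*F v i) (w≐0 i)) (R.zeroˡ (v i)))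

  ·-zeroʳ : ∀ {r} (w v : Vect F r) → v ≐ 0ᵥ → w · v ≡ 0#
  ·-zeroʳ w v v≐0 = trans (·-comm w v) (·-zeroˡ v w v≐0)

  kernel-count : ∀ r (v : Vect F r) → + q * ∑[ w ← vectors r ] δ (w · v) 0# ≡ N r + M r * δᵥ v 0ᵥ
  kernel-count zero v = begin
    + q * (δ 0# 0# + 0ℤ)   ≡⟨ cong (λ s → + q * (s + 0ℤ)) (δ-refl 0#) ⟩
    + q * 1ℤ               ≡⟨ N-suc 0 ⟨
    N 1                    ≡⟨ split (N 0) (N 1) ⟩
    N 0 + M 0 * 1ℤ         ∎
    where
    open ≡-Reasoning
    split : ∀ a b → b ≡ a + (b - a) * 1ℤ
    split = solve-∀
  kernel-count (suc r) v with head v ≟ 0#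
  ... | yes v₀≡0 = begin
    + q * ∑[ w ← vectors (suc r) ] δ (w · v) 0#
      ≡⟨ cong (+ q *_) (∑ᵥ-suc r _) ⟩
    + q * ∑[ a ← elements ] ∑[ w ← vectors r ] δ (a *F head v +F w · tail v) 0#
      ≡⟨ cong (+ q *_) (∑-cong elements λ a → ∑-cong (vectors r) λ w → cong (λ s → δ s 0#) (drop a w)) ⟩
    + q * ∑[ _ ← elements ] ∑[ w ← vectors r ] δ (w · tail v) 0#
      ≡⟨ cong (+ q *_) (∑-const elements _) ⟩
    + q * (+ q * ∑[ w ← vectors r ] δ (w · tail v) 0#)
      ≡⟨ cong (+ q *_) (kernel-count r (tail v)) ⟩
    + q * (N r + M r * δᵥ (tail v) 0ᵥ)
      ≡⟨ scale (+ q) (N r) (M r) _ ⟩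
    + q * N r + + q * M r * δᵥ (tail v) 0ᵥ
      ≡⟨ cong₂ (λ a b → a + b * δᵥ (tail v) 0ᵥ) (N-suc r) (M-suc r) ⟨
    N (suc r) + M (suc r) * δᵥ (tail v) 0ᵥ
      ∎
    where
    open ≡-Reasoning
    drop : ∀ a w → a *F head v +F w · tail v ≡ w · tail v
    drop a w = trans (cong (λ x → a *F x +F w · tail v) v₀≡0) (trans (cong (_+F w · tail v) (R.zeroʳ a)) (R.+-identityˡ _))
    scale : ∀ Q A B e → Q * (A + B * e) ≡ Q * A + Q * B * e
    scale = solve-∀
  ... | no v₀≢0 = begin
    + q * ∑[ w ← vectors (suc r) ] δ (w · v) 0#
      ≡⟨ cong (+ q *_) (∑ᵥ-suc r _) ⟩
    + q * ∑[ a ← elements ] ∑[ w ← vectors r ] δ (a *F head v +F w · tail v) 0#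
      ≡⟨ cong (+ q *_) (∑-swap elements (vectors r) _) ⟩
    + q * ∑[ w ← vectors r ] ∑[ a ← elements ] δ (a *F head v +F w · tail v) 0#
      ≡⟨ cong (+ q *_) (∑-cong (vectors r) λ w → ∑-δ-affine (head v) v₀≢0 (w · tail v) 0#) ⟩
    + q * ∑[ _ ← vectors r ] 1ℤ
      ≡⟨ cong (+ q *_) (trans (∑ᵥ-const r 1ℤ) (ℤ.*-identityʳ _)) ⟩
    + q * N r
      ≡⟨ N-suc r ⟨
    N (suc r)
      ≡⟨ trans (cong (λ s → N (suc r) + s) (ℤ.*-zeroʳ (M (suc r)))) (ℤ.+-identityʳ _) ⟨
    N (suc r) + M (suc r) * 0ℤ
      ∎
    where open ≡-Reasoning

  -- A weighted inequality for functions on F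

  collisions : (Carrier → ℤ) → ℤ
  collisions a = ∑[ s ← elements ] (a s * a s)

  threeAPs : (Carrier → ℤ) → ℤ
  threeAPs a = ∑[ s ← elements ] ∑[ t ← elements ] (a s * (a t * a (t +F t -F s)))

  module _ (1+1≢0 : 1# +F 1# ≢ 0#) (a : Carrier → ℤ) where
    open Halving 1+1≢0

    private
      reflect : Carrier → Carrier → Carrier
      reflect s t = t +F t -F s

      K : ℤ
      K = ∑ elements a

      reflect-involutive : ∀ t s → reflect (reflect s t) t ≡ s
      reflect-involutive t s =
        +G.∙-cancelʳ (t +F t -F s) _ _ (trans (sub-add (t +F t) (t +F t -F s)) (sym (trans (R.+-comm s _) (sub-add (t +F t) s))))

      ∑-reflectˡ : ∀ t (f : Carrier → ℤ) → ∑[ s ← elements ] f (reflect s t) ≡ ∑ elements f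
      ∑-reflectˡ t = ∑-reindex (λ s → reflect s t) (λ s → reflect s t) (reflect-involutive t) (reflect-involutive t)

      ∑-reflectʳ : ∀ s (f : Carrier → ℤ) → ∑[ t ← elements ] f (reflect s t) ≡ ∑ elements f
      ∑-reflectʳ s = ∑-reindex (reflect s) (λ y → (y +F s) *F half)
        (λ y → trans (cong (_-F s) (half+half (y +F s))) (add-sub y s))
        (λ t → trans (cong (_*F half) (sub-add (t +F t) s)) (double-half t))

    weighted-spread : ∀ μ D →
      ∑[ s ← elements ] ∑[ t ← elements ] ((μ - D * a t) * ((a s - a (reflect s t)) * (a s - a (reflect s t))))
        ≡ + 2 * ((+ q * μ - D * K) * collisions a - μ * (K * K) + D * threeAPs a)
    weighted-spread μ D = begin
      ∑[ s ← elements ] ∑[ t ← elements ] (c t * ((a s - a (reflect s t)) * (a s - a (reflect s t))))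
        ≡⟨ ∑-cong elements (λ s → ∑-cong elements λ t → expand μ D (a s) (a t) (a (reflect s t))) ⟩
      ∑[ s ← elements ] ∑[ t ← elements ] ((c t * (a s * a s) + c t * (a (reflect s t) * a (reflect s t)))
                                           + (- (+ 2 * μ) * (a s * a (reflect s t)) + + 2 * D * (a s * (a t * a (reflect s t)))))
        ≡⟨ trans (∑∑-+ elements elements _ _) (cong₂ _+_ (∑∑-+ elements elements _ _) (∑∑-+ elements elements _ _)) ⟩
      (∑[ s ← elements ] ∑[ t ← elements ] (c t * (a s * a s))
         + ∑[ s ← elements ] ∑[ t ← elements ] (c t * (a (reflect s t) * a (reflect s t))))
        + (∑[ s ← elements ] ∑[ t ← elements ] (- (+ 2 * μ) * (a s * a (reflect s t)))
           + ∑[ s ← elements ] ∑[ t ← elements ] (+ 2 * D * (a s * (a t * a (reflect s t)))))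
        ≡⟨ cong₂ _+_ (cong₂ _+_ weight-outer weight-inner)
                     (cong₂ _+_ products (∑∑-*ˡ elements elements (+ 2 * D) λ s t → a s * (a t * a (reflect s t)))) ⟩
      (C * collisions a + C * collisions a) + (- (+ 2 * μ) * (K * K) + + 2 * D * threeAPs a)
        ≡⟨ collect C (collisions a) μ K D (threeAPs a) ⟩
      + 2 * (C * collisions a - μ * (K * K) + D * threeAPs a)
        ∎
      where
      open ≡-Reasoning
      c : Carrier → ℤ
      c t = μ - D * a t
      C : ℤ
      C = + q * μ - D * K
      expand : ∀ μ D x y z → (μ - D * y) * ((x - z) * (x - z)) ≡
        ((μ - D * y) * (x * x) + (μ - D * y) * (z * z)) + (- (+ 2 * μ) * (x * z) + + 2 * D * (x * (y * z)))
      expand = solve-∀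
      collect : ∀ C S μ K D T → (C * S + C * S) + (- (+ 2 * μ) * (K * K) + + 2 * D * T) ≡
        + 2 * (C * S - μ * (K * K) + D * T)
      collect = solve-∀
      ∑-c : ∑ elements c ≡ C
      ∑-c = trans (∑-- elements (λ _ → μ) (λ t → D * a t)) (cong₂ _-_ (∑-const elements μ) (∑-*ˡ elements D a))
      weight-outer : ∑[ s ← elements ] ∑[ t ← elements ] (c t * (a s * a s)) ≡ C * collisions a
      weight-outer = begin
        ∑[ s ← elements ] ∑[ t ← elements ] (c t * (a s * a s)) ≡⟨ ∑-cong elements (λ s → ∑-*ʳ elements (a s * a s) c) ⟩
        ∑[ s ← elements ] (∑ elements c * (a s * a s))           ≡⟨ ∑-*ˡ elements (∑ elements c) (λ s → a s * a s) ⟩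
        ∑ elements c * collisions a                            ≡⟨ cong (_* collisions a) ∑-c ⟩
        C * collisions a                                       ∎
      weight-inner : ∑[ s ← elements ] ∑[ t ← elements ] (c t * (a (reflect s t) * a (reflect s t))) ≡ C * collisions a
      weight-inner = begin
        ∑[ s ← elements ] ∑[ t ← elements ] (c t * (a (reflect s t) * a (reflect s t)))
          ≡⟨ ∑-swap elements elements _ ⟩
        ∑[ t ← elements ] ∑[ s ← elements ] (c t * (a (reflect s t) * a (reflect s t)))
          ≡⟨ ∑-cong elements (λ t → trans (∑-*ˡ elements (c t) (λ s → a (reflect s t) * a (reflect s t)))
                                          (cong (c t *_) (∑-reflectˡ t λ y → a y * a y))) ⟩
        ∑[ t ← elements ] (c t * collisions a)
          ≡⟨ ∑-*ʳ elements (collisions a) c ⟩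
        ∑ elements c * collisions a
          ≡⟨ cong (_* collisions a) ∑-c ⟩
        C * collisions a
          ∎
      products : ∑[ s ← elements ] ∑[ t ← elements ] (- (+ 2 * μ) * (a s * a (reflect s t))) ≡ - (+ 2 * μ) * (K * K)
      products = begin
        ∑[ s ← elements ] ∑[ t ← elements ] (- (+ 2 * μ) * (a s * a (reflect s t)))
          ≡⟨ ∑∑-*ˡ elements elements (- (+ 2 * μ)) (λ s t → a s * a (reflect s t)) ⟩
        - (+ 2 * μ) * ∑[ s ← elements ] ∑[ t ← elements ] (a s * a (reflect s t))
          ≡⟨ cong (- (+ 2 * μ) *_) (∑-cong elements λ s → trans (∑-*ˡ elements (a s) _) (cong (a s *_) (∑-reflectʳ s a))) ⟩
        - (+ 2 * μ) * ∑[ s ← elements ] (a s * K)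
          ≡⟨ cong (- (+ 2 * μ) *_) (∑-*ʳ elements K a) ⟩
        - (+ 2 * μ) * (K * K)
          ∎

    -- Both sides are halves of Σₛ Σₜ c(t) (a(s) - a(2t - s))², with c = 1 on the left and c = μ - D a ≥ 1 on the right.
    weighted-bound : ∀ μ D → (∀ t → 1ℤ ℤ.≤ μ - D * a t) →
      + q * collisions a - K * K ℤ.≤ (+ q * μ - D * K) * collisions a - μ * (K * K) + D * threeAPs a
    weighted-bound μ D 1≤c = ℤ.*-cancelˡ-≤-pos _ _ (+ 2)
      (subst₂ ℤ._≤_ (trans (weighted-spread 1ℤ 0ℤ) (cong (+ 2 *_) (simplify (+ q) (collisions a) K (threeAPs a))))
                  (weighted-spread μ D)
        (∑-mono elements λ s → ∑-mono elements λ t →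
          let sq = a s - a (reflect s t) in
          ℤ.*-monoʳ-≤-nonNeg (sq * sq) {{nonNegative (0≤i*i sq)}} (ℤ.≤-trans (ℤ.≤-reflexive (1-0 (a t))) (1≤c t))))
      where
      simplify : ∀ Q S K T → (Q * 1ℤ - 0ℤ * K) * S - 1ℤ * (K * K) + 0ℤ * T ≡ Q * S - K * K
      simplify = solve-∀
      1-0 : ∀ x → 1ℤ - 0ℤ * x ≡ 1ℤ
      1-0 = solve-∀

  -- Summing over all linear forms

  ∑-kernel : ∀ {X : Set} r (ξs : List X) (g : X → ℤ) (v : X → Vect F r) →
    + q * ∑[ w ← vectors r ] ∑[ ξ ← ξs ] (g ξ * δ (w · v ξ) 0#)
      ≡ N r * ∑ ξs g + M r * ∑[ ξ ← ξs ] (g ξ * δᵥ (v ξ) 0ᵥ)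
  ∑-kernel r ξs g v = begin
    + q * ∑[ w ← vectors r ] ∑[ ξ ← ξs ] (g ξ * δ (w · v ξ) 0#)
      ≡⟨ cong (+ q *_) (∑-swap (vectors r) ξs _) ⟩
    + q * ∑[ ξ ← ξs ] ∑[ w ← vectors r ] (g ξ * δ (w · v ξ) 0#)
      ≡⟨ cong (+ q *_) (∑-cong ξs λ ξ → ∑-*ˡ (vectors r) (g ξ) (λ w → δ (w · v ξ) 0#)) ⟩
    + q * ∑[ ξ ← ξs ] (g ξ * ∑[ w ← vectors r ] δ (w · v ξ) 0#)
      ≡⟨ ∑-*ˡ ξs (+ q) _ ⟨
    ∑[ ξ ← ξs ] (+ q * (g ξ * ∑[ w ← vectors r ] δ (w · v ξ) 0#))
      ≡⟨ ∑-cong ξs (λ ξ → trans (swap (+ q) (g ξ) _) (cong (g ξ *_) (kernel-count r (v ξ)))) ⟩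
    ∑[ ξ ← ξs ] (g ξ * (N r + M r * δᵥ (v ξ) 0ᵥ))
      ≡⟨ ∑-cong ξs (λ ξ → distribute (g ξ) (N r) (M r) (δᵥ (v ξ) 0ᵥ)) ⟩
    ∑[ ξ ← ξs ] (N r * g ξ + M r * (g ξ * δᵥ (v ξ) 0ᵥ))
      ≡⟨ ∑-+ ξs _ _ ⟩
    ∑[ ξ ← ξs ] (N r * g ξ) + ∑[ ξ ← ξs ] (M r * (g ξ * δᵥ (v ξ) 0ᵥ))
      ≡⟨ cong₂ _+_ (∑-*ˡ ξs (N r) g) (∑-*ˡ ξs (M r) (λ ξ → g ξ * δᵥ (v ξ) 0ᵥ)) ⟩
    N r * ∑ ξs g + M r * ∑[ ξ ← ξs ] (g ξ * δᵥ (v ξ) 0ᵥ)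
      ∎
    where
    open ≡-Reasoning
    swap : ∀ a b c → a * (b * c) ≡ b * (a * c)
    swap = solve-∀
    distribute : ∀ g n m e → g * (n + m * e) ≡ n * g + m * (g * e)
    distribute = solve-∀

  δᵥ-⊖ : ∀ {r} (x y : Vect F r) → δᵥ (y ⊖ x) 0ᵥ ≡ δᵥ x y
  δᵥ-⊖ x y = cong 𝟙 (does-⇔
    (mk⇔ (λ y-x≐0 i → sym (+G.x∙y⁻¹≈ε⇒x≈y (y i) (x i) (y-x≐0 i))) (λ x≐y i → +G.x≈y⇒x∙y⁻¹≈ε (sym (x≐y i))))
    ((y ⊖ x) ≐? 0ᵥ) (x ≐? y))

  pairs : ∀ r → List (Vect F r × Vect F r)
  pairs r = vectors r ⊗ vectors r

  triples : ∀ r → List ((Vect F r × Vect F r) × Vect F r)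
  triples r = pairs r ⊗ vectors r

  ∑-triples : ∀ r (f : (Vect F r × Vect F r) × Vect F r → ℤ) →
    ∑ (triples r) f ≡ ∑[ x ← vectors r ] ∑[ y ← vectors r ] ∑[ z ← vectors r ] f ((x , y) , z)
  ∑-triples r f = trans (∑-⊗ (pairs r) (vectors r) f) (∑-⊗ (vectors r) (vectors r) _)

  difference : ∀ {r} → Vect F r × Vect F r → Vect F r
  difference (x , y) = y ⊖ x

  apDefect : ∀ {r} → (Vect F r × Vect F r) × Vect F r → Vect F r
  apDefect ((x , y) , z) = (z ⊕ x) ⊖ (y ⊕ y)

  δ-apDefect : ∀ {r} (w : Vect F r) x y z →
    δ (w · z) (w · y +F w · y -F w · x) ≡ δ (w · apDefect ((x , y) , z)) 0#
  δ-apDefect w x y z = begin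
    δ (w · z) (w · y +F w · y -F w · x)    ≡⟨ δ-add (w · z) (w · x) _ ⟩
    δ (w · z +F w · x) (w · y +F w · y)    ≡⟨ cong₂ δ (·-⊕ʳ w z x) (·-⊕ʳ w y y) ⟨
    δ (w · (z ⊕ x)) (w · (y ⊕ y))          ≡⟨ δ-sub _ _ ⟩
    δ (w · (z ⊕ x) -F w · (y ⊕ y)) 0#      ≡⟨ cong (λ s → δ s 0#) (·-⊖ʳ w (z ⊕ x) (y ⊕ y)) ⟨
    δ (w · apDefect ((x , y) , z)) 0#      ∎
    where open ≡-Reasoning

  first middle last : ∀ {r} → (Vect F r × Vect F r) × Vect F r → Vect F r
  first ((x , _) , _) = x
  middle ((_ , y) , _) = y
  last (_ , z) = z

  ∑-apDefect-last : ∀ r (f : Vect F r → Vect F r → ℤ) →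
    ∑[ ξ ← triples r ] (f (first ξ) (middle ξ) * δᵥ (apDefect ξ) 0ᵥ) ≡ ∑[ x ← vectors r ] ∑ (vectors r) (f x)
  ∑-apDefect-last r f = trans (∑-triples r _) (∑-cong (vectors r) λ x → ∑-cong (vectors r) λ y →
    trans (∑-*ˡ (vectors r) (f x y) _) (trans (cong (f x y *_) (solve x y)) (ℤ.*-identityʳ (f x y))))
    where
    solve : ∀ x y → ∑[ z ← vectors r ] δᵥ (apDefect ((x , y) , z)) 0ᵥ ≡ 1ℤ
    solve x y = trans (∑-cong (vectors r) λ z → cong 𝟙 (does-⇔ (mk⇔
        (λ U≐0 i → trans (sym (add-sub (z i) (x i))) (cong (_-F x i) (+G.x∙y⁻¹≈ε⇒x≈y _ _ (U≐0 i))))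
        (λ z≐c i → +G.x≈y⇒x∙y⁻¹≈ε (trans (cong (_+F x i) (z≐c i)) (sub-add (y i +F y i) (x i)))))
        (apDefect ((x , y) , z) ≐? 0ᵥ) (z ≐? ((y ⊕ y) ⊖ x))))
      (∑-δᵥ r ((y ⊕ y) ⊖ x))

  ∑-apDefect-first : ∀ r (f : Vect F r → Vect F r → ℤ) →
    ∑[ ξ ← triples r ] (f (middle ξ) (last ξ) * δᵥ (apDefect ξ) 0ᵥ) ≡ ∑[ y ← vectors r ] ∑ (vectors r) (f y)
  ∑-apDefect-first r f = begin
    ∑[ ξ ← triples r ] (f (middle ξ) (last ξ) * δᵥ (apDefect ξ) 0ᵥ)
      ≡⟨ ∑-triples r _ ⟩
    ∑[ x ← vectors r ] ∑[ y ← vectors r ] ∑[ z ← vectors r ] (f y z * δᵥ (apDefect ((x , y) , z)) 0ᵥ)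
      ≡⟨ ∑-swap (vectors r) (vectors r) _ ⟩
    ∑[ y ← vectors r ] ∑[ x ← vectors r ] ∑[ z ← vectors r ] (f y z * δᵥ (apDefect ((x , y) , z)) 0ᵥ)
      ≡⟨ ∑-cong (vectors r) (λ y → ∑-swap (vectors r) (vectors r) _) ⟩
    ∑[ y ← vectors r ] ∑[ z ← vectors r ] ∑[ x ← vectors r ] (f y z * δᵥ (apDefect ((x , y) , z)) 0ᵥ)
      ≡⟨ ∑-cong (vectors r) (λ y → ∑-cong (vectors r) λ z →
           trans (∑-*ˡ (vectors r) (f y z) _) (trans (cong (f y z *_) (solve y z)) (ℤ.*-identityʳ (f y z)))) ⟩
    ∑[ y ← vectors r ] ∑ (vectors r) (f y)
      ∎
    where
    open ≡-Reasoning
    solve : ∀ y z → ∑[ x ← vectors r ] δᵥ (apDefect ((x , y) , z)) 0ᵥ ≡ 1ℤ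
    solve y z = trans (∑-cong (vectors r) λ x → cong 𝟙 (does-⇔ (mk⇔
        (λ U≐0 i → trans (sym (add-sub (x i) (z i)))
                         (cong (_-F z i) (trans (R.+-comm (x i) (z i)) (+G.x∙y⁻¹≈ε⇒x≈y _ _ (U≐0 i)))))
        (λ x≐c i → +G.x≈y⇒x∙y⁻¹≈ε (trans (R.+-comm (z i) (x i)) (trans (cong (_+F z i) (x≐c i)) (sub-add (y i +F y i) (z i))))))
        (apDefect ((x , y) , z) ≐? 0ᵥ) (x ≐? ((y ⊕ y) ⊖ z))))
      (∑-δᵥ r ((y ⊕ y) ⊖ z))

  -- Slices of a subset of F^r

  #_ : ∀ {r} → Subset F r → ℤ
  #_ {r} A = ∑[ x ← vectors r ] 𝟙 (A x)

  module _ {r : ℕ} (A : Subset F r) where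

    slice : Vect F r → Carrier → ℤ
    slice w t = ∑[ x ← vectors r ] (𝟙 (A x) * δ (w · x) t)

    ∑-slice : ∀ w (f : Carrier → ℤ) →
      ∑[ t ← elements ] (slice w t * f t) ≡ ∑[ x ← vectors r ] (𝟙 (A x) * f (w · x))
    ∑-slice w f = begin
      ∑[ t ← elements ] (slice w t * f t)
        ≡⟨ ∑-cong elements (λ t → ∑-*ʳ (vectors r) (f t) _) ⟨
      ∑[ t ← elements ] ∑[ x ← vectors r ] (𝟙 (A x) * δ (w · x) t * f t)
        ≡⟨ ∑-swap elements (vectors r) _ ⟩
      ∑[ x ← vectors r ] ∑[ t ← elements ] (𝟙 (A x) * δ (w · x) t * f t)
        ≡⟨ ∑-cong (vectors r) (λ x → trans (∑-cong elements λ t → ℤ.*-assoc (𝟙 (A x)) _ _) (∑-*ˡ elements (𝟙 (A x)) _)) ⟩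
      ∑[ x ← vectors r ] (𝟙 (A x) * ∑[ t ← elements ] (δ (w · x) t * f t))
        ≡⟨ ∑-cong (vectors r) (λ x → cong (𝟙 (A x) *_) (∑-δ′ (w · x) f)) ⟩
      ∑[ x ← vectors r ] (𝟙 (A x) * f (w · x))
        ∎
      where open ≡-Reasoning

    #A≤N : # A ℤ.≤ N r
    #A≤N = ℤ.≤-trans (∑-mono (vectors r) λ x → 𝟙≤1 (A x)) (ℤ.≤-reflexive (trans (∑ᵥ-const r 1ℤ) (ℤ.*-identityʳ (N r))))

    ∑-slice₁ : ∀ w → ∑ elements (slice w) ≡ # A
    ∑-slice₁ w = trans (∑-cong elements λ t → sym (ℤ.*-identityʳ (slice w t)))
                       (trans (∑-slice w (λ _ → 1ℤ)) (∑-cong (vectors r) λ x → ℤ.*-identityʳ (𝟙 (A x))))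

    slice-zero : ∀ w → w ≐ 0ᵥ → ∀ t → slice w t ≡ δ 0# t * # A
    slice-zero w w≐0 t = trans (∑-cong (vectors r) λ x → cong (λ s → 𝟙 (A x) * δ s t) (·-zeroˡ w x w≐0))
                               (trans (∑-*ʳ (vectors r) (δ 0# t) _) (ℤ.*-comm (# A) _))

    collisions-zero : ∀ w → w ≐ 0ᵥ → collisions (slice w) ≡ # A * # A
    collisions-zero w w≐0 = begin
      ∑[ s ← elements ] (slice w s * slice w s)
        ≡⟨ ∑-cong elements (λ s → cong₂ _*_ (slice-zero w w≐0 s) (slice-zero w w≐0 s)) ⟩
      ∑[ s ← elements ] (δ 0# s * # A * (δ 0# s * # A))
        ≡⟨ ∑-cong elements (λ s → trans (square (δ 0# s) (# A)) (cong (_* (# A * # A)) (δ-idem 0# s))) ⟩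
      ∑[ s ← elements ] (δ 0# s * (# A * # A))
        ≡⟨ ∑-δ′ 0# _ ⟩
      # A * # A
        ∎
      where
      open ≡-Reasoning
      square : ∀ d k → d * k * (d * k) ≡ d * d * (k * k)
      square = solve-∀

    threeAPs-zero : ∀ w → w ≐ 0ᵥ → threeAPs (slice w) ≡ # A * # A * # A
    threeAPs-zero w w≐0 = begin
      ∑[ s ← elements ] ∑[ t ← elements ] (slice w s * (slice w t * slice w (t +F t -F s)))
        ≡⟨ ∑-cong elements (λ s → trans (∑-cong elements λ t → shift s t) (∑-*ˡ elements (δ 0# s) _)) ⟩
      ∑[ s ← elements ] (δ 0# s * ∑[ t ← elements ] (δ 0# t * (# A * (# A * slice w (t +F t -F s)))))
        ≡⟨ ∑-δ′ 0# _ ⟩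
      ∑[ t ← elements ] (δ 0# t * (# A * (# A * slice w (t +F t -F 0#))))
        ≡⟨ ∑-δ′ 0# _ ⟩
      # A * (# A * slice w (0# +F 0# -F 0#))
        ≡⟨ cong (λ k → # A * (# A * k)) (trans (slice-zero w w≐0 _) (cong (_* # A) (trans (cong (δ 0#) 0+0-0≡0) (δ-refl 0#)))) ⟩
      # A * (# A * (1ℤ * # A))
        ≡⟨ cube (# A) ⟩
      # A * # A * # A
        ∎
      where
      open ≡-Reasoning
      shift : ∀ s t → slice w s * (slice w t * slice w (t +F t -F s))
                      ≡ δ 0# s * (δ 0# t * (# A * (# A * slice w (t +F t -F s))))
      shift s t = trans (cong₂ (λ a b → a * (b * slice w (t +F t -F s))) (slice-zero w w≐0 s) (slice-zero w w≐0 t))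
                        (move (δ 0# s) (δ 0# t) (# A) _)
        where
        move : ∀ a b k x → a * k * (b * k * x) ≡ a * (b * (k * (k * x)))
        move = solve-∀
      0+0-0≡0 : 0# +F 0# -F 0# ≡ 0#
      0+0-0≡0 = add-sub 0# 0#
      cube : ∀ k → k * (k * (1ℤ * k)) ≡ k * k * k
      cube = solve-∀

    pairWeight : Vect F r × Vect F r → ℤ
    pairWeight (x , y) = 𝟙 (A x) * 𝟙 (A y)

    tripleWeight : (Vect F r × Vect F r) × Vect F r → ℤ
    tripleWeight (xy , z) = pairWeight xy * 𝟙 (A z)

    collisions-slice : ∀ w → collisions (slice w) ≡ ∑[ ξ ← pairs r ] (pairWeight ξ * δ (w · difference ξ) 0#)
    collisions-slice w = begin
      collisions (slice w)
        ≡⟨ ∑-slice w (slice w) ⟩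
      ∑[ x ← vectors r ] (𝟙 (A x) * ∑[ y ← vectors r ] (𝟙 (A y) * δ (w · y) (w · x)))
        ≡⟨ ∑-cong (vectors r) (λ x → ∑-*ˡ (vectors r) (𝟙 (A x)) _) ⟨
      ∑[ x ← vectors r ] ∑[ y ← vectors r ] (𝟙 (A x) * (𝟙 (A y) * δ (w · y) (w · x)))
        ≡⟨ ∑-cong (vectors r) (λ x → ∑-cong (vectors r) λ y → trans (sym (ℤ.*-assoc (𝟙 (A x)) _ _))
             (cong (pairWeight (x , y) *_) (trans (δ-sub (w · y) (w · x)) (cong (λ s → δ s 0#) (sym (·-⊖ʳ w y x)))))) ⟩
      ∑[ x ← vectors r ] ∑[ y ← vectors r ] (pairWeight (x , y) * δ (w · (y ⊖ x)) 0#)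
        ≡⟨ ∑-⊗ (vectors r) (vectors r) _ ⟨
      ∑[ ξ ← pairs r ] (pairWeight ξ * δ (w · difference ξ) 0#)
        ∎
      where open ≡-Reasoning

    threeAPs-slice : ∀ w → threeAPs (slice w) ≡ ∑[ ξ ← triples r ] (tripleWeight ξ * δ (w · apDefect ξ) 0#)
    threeAPs-slice w = begin
      threeAPs (slice w)
        ≡⟨ ∑-cong elements (λ s → ∑-*ˡ elements (slice w s) _) ⟩
      ∑[ s ← elements ] (slice w s * ∑[ t ← elements ] (slice w t * slice w (t +F t -F s)))
        ≡⟨ ∑-slice w _ ⟩
      ∑[ x ← vectors r ] (𝟙 (A x) * ∑[ t ← elements ] (slice w t * slice w (t +F t -F w · x)))
        ≡⟨ ∑-cong (vectors r) (λ x → cong (𝟙 (A x) *_) (∑-slice w _)) ⟩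
      ∑[ x ← vectors r ] (𝟙 (A x) * ∑[ y ← vectors r ] (𝟙 (A y) * slice w (w · y +F w · y -F w · x)))
        ≡⟨ ∑-cong (vectors r) (λ x → cong (𝟙 (A x) *_) (∑-cong (vectors r) λ y → cong (𝟙 (A y) *_) (inner x y))) ⟩
      ∑[ x ← vectors r ] (𝟙 (A x) * ∑[ y ← vectors r ] (𝟙 (A y) * ∑[ z ← vectors r ] (𝟙 (A z) * e x y z)))
        ≡⟨ ∑-cong (vectors r) (λ x → trans (cong (𝟙 (A x) *_) (∑-cong (vectors r) λ y → sym (∑-*ˡ (vectors r) (𝟙 (A y)) _)))
                                    (sym (∑-*ˡ (vectors r) (𝟙 (A x)) _))) ⟩
      ∑[ x ← vectors r ] ∑[ y ← vectors r ] (𝟙 (A x) * ∑[ z ← vectors r ] (𝟙 (A y) * (𝟙 (A z) * e x y z)))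
        ≡⟨ ∑-cong (vectors r) (λ x → ∑-cong (vectors r) λ y → trans (sym (∑-*ˡ (vectors r) (𝟙 (A x)) _))
                                    (∑-cong (vectors r) λ z → reassoc (𝟙 (A x)) (𝟙 (A y)) (𝟙 (A z)) (e x y z))) ⟩
      ∑[ x ← vectors r ] ∑[ y ← vectors r ] ∑[ z ← vectors r ] (tripleWeight ((x , y) , z) * e x y z)
        ≡⟨ ∑-triples r _ ⟨
      ∑[ ξ ← triples r ] (tripleWeight ξ * δ (w · apDefect ξ) 0#)
        ∎
      where
      open ≡-Reasoning
      e : Vect F r → Vect F r → Vect F r → ℤ
      e x y z = δ (w · apDefect ((x , y) , z)) 0#
      inner : ∀ x y → slice w (w · y +F w · y -F w · x) ≡ ∑[ z ← vectors r ] (𝟙 (A z) * e x y z)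
      inner x y = ∑-cong (vectors r) λ z → cong (𝟙 (A z) *_) (δ-apDefect w x y z)
      reassoc : ∀ a b c d → a * (b * (c * d)) ≡ a * b * c * d
      reassoc = solve-∀

    ∑-pairWeight : ∑ (pairs r) pairWeight ≡ # A * # A
    ∑-pairWeight = begin
      ∑ (pairs r) pairWeight                                    ≡⟨ ∑-⊗ (vectors r) (vectors r) pairWeight ⟩
      ∑[ x ← vectors r ] ∑[ y ← vectors r ] (𝟙 (A x) * 𝟙 (A y)) ≡⟨ ∑-cong (vectors r) (λ x → ∑-*ˡ (vectors r) (𝟙 (A x)) _) ⟩
      ∑[ x ← vectors r ] (𝟙 (A x) * # A)                        ≡⟨ ∑-*ʳ (vectors r) (# A) _ ⟩
      # A * # A                                                 ∎
      where open ≡-Reasoning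

    ∑-tripleWeight : ∑ (triples r) tripleWeight ≡ # A * # A * # A
    ∑-tripleWeight = begin
      ∑ (triples r) tripleWeight                                   ≡⟨ ∑-⊗ (pairs r) (vectors r) tripleWeight ⟩
      ∑[ ξ ← pairs r ] ∑[ z ← vectors r ] (pairWeight ξ * 𝟙 (A z)) ≡⟨ ∑-cong (pairs r) (λ ξ → ∑-*ˡ (vectors r) (pairWeight ξ) _) ⟩
      ∑[ ξ ← pairs r ] (pairWeight ξ * # A)                        ≡⟨ ∑-*ʳ (pairs r) (# A) pairWeight ⟩
      ∑ (pairs r) pairWeight * # A                                 ≡⟨ cong (_* # A) ∑-pairWeight ⟩
      # A * # A * # A                                              ∎
      where open ≡-Reasoning

    ∑-pairWeight-diagonal : ∑[ ξ ← pairs r ] (pairWeight ξ * δᵥ (difference ξ) 0ᵥ) ≡ # A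
    ∑-pairWeight-diagonal = begin
      ∑[ ξ ← pairs r ] (pairWeight ξ * δᵥ (difference ξ) 0ᵥ)
        ≡⟨ ∑-⊗ (vectors r) (vectors r) _ ⟩
      ∑[ x ← vectors r ] ∑[ y ← vectors r ] (pairWeight (x , y) * δᵥ (y ⊖ x) 0ᵥ)
        ≡⟨ ∑-cong (vectors r) (λ x → ∑-cong (vectors r) λ y →
             trans (cong (pairWeight (x , y) *_) (δᵥ-⊖ x y)) (ℤ.*-comm (pairWeight (x , y)) (δᵥ x y))) ⟩
      ∑[ x ← vectors r ] ∑[ y ← vectors r ] (δᵥ x y * pairWeight (x , y))
        ≡⟨ ∑ᵥ-diagonal r (λ x y → pairWeight (x , y)) ⟩
      ∑[ x ← vectors r ] (𝟙 (A x) * 𝟙 (A x))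
        ≡⟨ ∑-cong (vectors r) (λ x → 𝟙-idem (A x)) ⟩
      # A
        ∎
      where open ≡-Reasoning

    ∑-collisions : + q * ∑[ w ← vectors r ] collisions (slice w) ≡ N r * (# A * # A) + M r * # A
    ∑-collisions = begin
      + q * ∑[ w ← vectors r ] collisions (slice w)
        ≡⟨ cong (+ q *_) (∑-cong (vectors r) collisions-slice) ⟩
      + q * ∑[ w ← vectors r ] ∑[ ξ ← pairs r ] (pairWeight ξ * δ (w · difference ξ) 0#)
        ≡⟨ ∑-kernel r (pairs r) pairWeight difference ⟩
      N r * ∑ (pairs r) pairWeight + M r * ∑[ ξ ← pairs r ] (pairWeight ξ * δᵥ (difference ξ) 0ᵥ)
        ≡⟨ cong₂ (λ a b → N r * a + M r * b) ∑-pairWeight ∑-pairWeight-diagonal ⟩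
      N r * (# A * # A) + M r * # A
        ∎
      where open ≡-Reasoning

    module _ (1+1≢0 : 1# +F 1# ≢ 0#) (A-pf : ProgressionFree F A) where
      open Halving 1+1≢0

      δᵥ-apDefect : ∀ x y z → A x ≡ true → A y ≡ true → A z ≡ true →
        δᵥ (apDefect ((x , y) , z)) 0ᵥ ≡ δᵥ x y * δᵥ z y
      δᵥ-apDefect x y z ax ay az =
        trans (cong 𝟙 (does-⇔ (mk⇔ trivial constant) (apDefect ((x , y) , z) ≐? 0ᵥ) ((x ≐? y) Dec.×-dec (z ≐? y))))
              (𝟙-∧ (does (x ≐? y)) (does (z ≐? y)))
        where
        trivial : apDefect ((x , y) , z) ≐ 0ᵥ → x ≐ y × z ≐ y
        trivial U≐0 = x≐y , λ i → trans (sym (x≐z i)) (x≐y i)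
          where
          z+x≡y+y : ∀ i → z i +F x i ≡ y i +F y i
          z+x≡y+y i = +G.x∙y⁻¹≈ε⇒x≈y _ _ (U≐0 i)
          x≐z : x ≐ z
          x≐z = A-pf x y z ax ay az (λ i → trans (R.+-comm (x i) (z i)) (z+x≡y+y i))
          x≐y : x ≐ y
          x≐y i = +-halve (trans (cong (x i +F_) (x≐z i)) (trans (R.+-comm (x i) (z i)) (z+x≡y+y i)))
        constant : x ≐ y × z ≐ y → apDefect ((x , y) , z) ≐ 0ᵥ
        constant (x≐y , z≐y) i = +G.x≈y⇒x∙y⁻¹≈ε (cong₂ _+F_ (z≐y i) (x≐y i))

      tripleWeight-apDefect : ∀ x y z →
        tripleWeight ((x , y) , z) * δᵥ (apDefect ((x , y) , z)) 0ᵥ ≡ δᵥ x y * (δᵥ z y * tripleWeight ((x , y) , z))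
      tripleWeight-apDefect x y z = begin
        𝟙 (A x) * 𝟙 (A y) * 𝟙 (A z) * δᵥ (apDefect ((x , y) , z)) 0ᵥ  ≡⟨ nest (𝟙 (A x)) (𝟙 (A y)) (𝟙 (A z)) _ ⟩
        𝟙 (A x) * (𝟙 (A y) * (𝟙 (A z) * δᵥ (apDefect ((x , y) , z)) 0ᵥ))
          ≡⟨ 𝟙-guard (A x) (λ ax → 𝟙-guard (A y) λ ay → 𝟙-guard (A z) λ az → δᵥ-apDefect x y z ax ay az) ⟩
        𝟙 (A x) * (𝟙 (A y) * (𝟙 (A z) * (δᵥ x y * δᵥ z y)))            ≡⟨ move (𝟙 (A x)) (𝟙 (A y)) (𝟙 (A z)) (δᵥ x y) (δᵥ z y) ⟩
        δᵥ x y * (δᵥ z y * (𝟙 (A x) * 𝟙 (A y) * 𝟙 (A z)))              ∎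
        where
        open ≡-Reasoning
        nest : ∀ a b c d → a * b * c * d ≡ a * (b * (c * d))
        nest = solve-∀
        move : ∀ a b c d e → a * (b * (c * (d * e))) ≡ d * (e * (a * b * c))
        move = solve-∀

      ∑-tripleWeight-diagonal : ∑[ ξ ← triples r ] (tripleWeight ξ * δᵥ (apDefect ξ) 0ᵥ) ≡ # A
      ∑-tripleWeight-diagonal = begin
        ∑[ ξ ← triples r ] (tripleWeight ξ * δᵥ (apDefect ξ) 0ᵥ)
          ≡⟨ ∑-triples r _ ⟩
        ∑[ x ← vectors r ] ∑[ y ← vectors r ] ∑[ z ← vectors r ] (tripleWeight ((x , y) , z) * δᵥ (apDefect ((x , y) , z)) 0ᵥ)
          ≡⟨ ∑-cong (vectors r) (λ x → ∑-cong (vectors r) λ y →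
               trans (∑-cong (vectors r) (tripleWeight-apDefect x y)) (∑-*ˡ (vectors r) (δᵥ x y) _)) ⟩
        ∑[ x ← vectors r ] ∑[ y ← vectors r ] (δᵥ x y * ∑[ z ← vectors r ] (δᵥ z y * tripleWeight ((x , y) , z)))
          ≡⟨ ∑ᵥ-diagonal r _ ⟩
        ∑[ x ← vectors r ] ∑[ z ← vectors r ] (δᵥ z x * tripleWeight ((x , x) , z))
          ≡⟨ ∑-swap (vectors r) (vectors r) _ ⟩
        ∑[ z ← vectors r ] ∑[ x ← vectors r ] (δᵥ z x * tripleWeight ((x , x) , z))
          ≡⟨ ∑ᵥ-diagonal r (λ z x → tripleWeight ((x , x) , z)) ⟩
        ∑[ z ← vectors r ] (𝟙 (A z) * 𝟙 (A z) * 𝟙 (A z))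
          ≡⟨ ∑-cong (vectors r) (λ z → trans (cong (_* 𝟙 (A z)) (𝟙-idem (A z))) (𝟙-idem (A z))) ⟩
        # A
          ∎
        where open ≡-Reasoning

      ∑-threeAPs : + q * ∑[ w ← vectors r ] threeAPs (slice w) ≡ N r * (# A * # A * # A) + M r * # A
      ∑-threeAPs = begin
        + q * ∑[ w ← vectors r ] threeAPs (slice w)
          ≡⟨ cong (+ q *_) (∑-cong (vectors r) threeAPs-slice) ⟩
        + q * ∑[ w ← vectors r ] ∑[ ξ ← triples r ] (tripleWeight ξ * δ (w · apDefect ξ) 0#)
          ≡⟨ ∑-kernel r (triples r) tripleWeight apDefect ⟩
        N r * ∑ (triples r) tripleWeight + M r * ∑[ ξ ← triples r ] (tripleWeight ξ * δᵥ (apDefect ξ) 0ᵥ)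
          ≡⟨ cong₂ (λ a b → N r * a + M r * b) ∑-tripleWeight ∑-tripleWeight-diagonal ⟩
        N r * (# A * # A * # A) + M r * # A
          ∎
        where open ≡-Reasoning

      inclusion-exclusion :
        ∑[ ξ ← triples r ] ((𝟙 (A (first ξ)) + 𝟙 (A (middle ξ)) + 𝟙 (A (last ξ)) - + 2) * δᵥ (apDefect ξ) 0ᵥ)
          ≡ N r * (+ 3 * # A - + 2 * N r)
      inclusion-exclusion = begin
        ∑[ ξ ← triples r ] ((a ξ + b ξ + c ξ - + 2) * e ξ)
          ≡⟨ ∑-cong (triples r) (λ ξ → expand (a ξ) (b ξ) (c ξ) (e ξ)) ⟩
        ∑[ ξ ← triples r ] (a ξ * e ξ + b ξ * e ξ + c ξ * e ξ + - + 2 * (1ℤ * e ξ))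
          ≡⟨ trans (∑-+ (triples r) _ _)
                   (cong₂ _+_ (trans (∑-+ (triples r) _ _) (cong (_+ ∑[ ξ ← triples r ] (c ξ * e ξ)) (∑-+ (triples r) _ _)))
                                                    (∑-*ˡ (triples r) (- + 2) _)) ⟩
        ∑[ ξ ← triples r ] (a ξ * e ξ) + ∑[ ξ ← triples r ] (b ξ * e ξ) + ∑[ ξ ← triples r ] (c ξ * e ξ)
          + - + 2 * ∑[ ξ ← triples r ] (1ℤ * e ξ)
          ≡⟨ cong₂ (λ s t → s + - + 2 * t)
               (cong₂ _+_ (cong₂ _+_ (trans (∑-apDefect-last r λ x _ → 𝟙 (A x)) on-first)
                                     (trans (∑-apDefect-last r λ _ y → 𝟙 (A y)) on-second))
                          (trans (∑-apDefect-first r λ _ z → 𝟙 (A z)) on-second))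
               (trans (∑-apDefect-last r λ _ _ → 1ℤ) on-none) ⟩
        N r * # A + N r * # A + N r * # A + - + 2 * (N r * (N r * 1ℤ))
          ≡⟨ collect (N r) (# A) ⟩
        N r * (+ 3 * # A - + 2 * N r)
          ∎
        where
        open ≡-Reasoning
        a b c e : (Vect F r × Vect F r) × Vect F r → ℤ
        a ξ = 𝟙 (A (first ξ))
        b ξ = 𝟙 (A (middle ξ))
        c ξ = 𝟙 (A (last ξ))
        e ξ = δᵥ (apDefect ξ) 0ᵥ
        expand : ∀ a b c e → (a + b + c - + 2) * e ≡ a * e + b * e + c * e + - + 2 * (1ℤ * e)
        expand = solve-∀
        collect : ∀ n k → n * k + n * k + n * k + - + 2 * (n * (n * 1ℤ)) ≡ n * (+ 3 * k - + 2 * n)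
        collect = solve-∀
        on-first : ∑[ x ← vectors r ] ∑[ _ ← vectors r ] 𝟙 (A x) ≡ N r * # A
        on-first = trans (∑-cong (vectors r) λ x → ∑ᵥ-const r (𝟙 (A x))) (∑-*ˡ (vectors r) (N r) _)
        on-second : ∑[ _ ← vectors r ] ∑[ y ← vectors r ] 𝟙 (A y) ≡ N r * # A
        on-second = ∑ᵥ-const r (# A)
        on-none : ∑[ _ ← vectors r ] ∑[ _ ← vectors r ] 1ℤ ≡ N r * (N r * 1ℤ)
        on-none = trans (∑-cong (vectors r) λ _ → ∑ᵥ-const r 1ℤ) (∑ᵥ-const r _)

      -- Bonferroni: at least 3|A|N - 2N² of the N² progressions lie in A, and only the |A| trivial ones do.
      #A-lower-bound : N r * (+ 3 * # A - + 2 * N r) ℤ.≤ # A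
      #A-lower-bound = begin
        N r * (+ 3 * # A - + 2 * N r)
          ≡⟨ inclusion-exclusion ⟨
        ∑[ ξ ← triples r ] ((𝟙 (A (first ξ)) + 𝟙 (A (middle ξ)) + 𝟙 (A (last ξ)) - + 2) * δᵥ (apDefect ξ) 0ᵥ)
          ≤⟨ ∑-mono (triples r) (λ ξ → ℤ.*-monoʳ-≤-nonNeg (δᵥ (apDefect ξ) 0ᵥ) {{nonNegative (0≤𝟙 _)}}
                                         (𝟙+𝟙+𝟙-2≤𝟙*𝟙*𝟙 (A (first ξ)) (A (middle ξ)) (A (last ξ)))) ⟩
        ∑[ ξ ← triples r ] (tripleWeight ξ * δᵥ (apDefect ξ) 0ᵥ)
          ≡⟨ ∑-tripleWeight-diagonal ⟩
        # A
          ∎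
        where open ℤ.≤-Reasoning

      #A<N : 1ℤ ℤ.< N r → # A ℤ.< N r
      #A<N 1<N = ℤ.≤∧≢⇒< #A≤N λ #A≡N → ℤ.<⇒≱ N<N*N (subst (λ k → N r * (+ 3 * k - + 2 * N r) ℤ.≤ k) #A≡N #A-lower-bound)
        where
        N<N*N : N r ℤ.< N r * (+ 3 * N r - + 2 * N r)
        N<N*N = subst₂ ℤ._<_ (ℤ.*-identityʳ (N r)) (cong (N r *_) (three-two (N r)))
                    (ℤ.*-monoˡ-<-pos (N r) {{positive (ℤ.<-trans (+<+ (s≤s z≤n)) 1<N)}} 1<N)
          where
          three-two : ∀ n → n ≡ + 3 * n - + 2 * n
          three-two = solve-∀

  -- Sparse slices are impossible

  module _ {r : ℕ} (A : Subset F r) where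

    private
      K : ℤ
      K = # A

    μ D : ℤ
    μ = N r * (# A - 1ℤ)
    D = + q * (N r - # A)

    -- D a < μ says that a slice of size a has density a q / N below (|A| - 1) / (N - |A|).
    SparseSlices : Vect F r → Set
    SparseSlices w = ¬ w ≐ 0ᵥ → ∀ t → D * slice A w t ℤ.< μ

    dense-slice-or-sparse : (Σ[ w ∈ Vect F r ] Σ[ t ∈ Carrier ] ¬ w ≐ 0ᵥ × μ ℤ.≤ D * slice A w t)
                            ⊎ All SparseSlices (vectors r)
    dense-slice-or-sparse with any? (λ w → ¬? (w ≐? 0ᵥ) Dec.×-dec any? (λ t → μ ℤ.≤? D * slice A w t) elements) (vectors r)
    ... | yes found =
      let (w , w≢0 , dense-somewhere) = Any.satisfied found
          (t , dense) = Any.satisfied dense-somewhere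
      in inj₁ (w , t , w≢0 , dense)
    ... | no none = inj₂ (All.map (λ {w} not-dense w≢0 t → ℤ.≰⇒> λ dense →
            not-dense (w≢0 , Any.map (λ t≡t′ → subst (λ s → μ ℤ.≤ D * slice A w s) t≡t′ dense) (elements-complete t)))
          (¬Any⇒All¬ (vectors r) none))

    module _ (1+1≢0 : 1# +F 1# ≢ 0#) (A-pf : ProgressionFree F A) where

      -- The term δᵥ w 0ᵥ * Z makes lower and upper agree at w = 0, where the weighted bound does not apply.
      private
        Z : ℤ
        Z = (+ q - 1ℤ) * (μ - 1ℤ) * (K * K)

        upper lower : Vect F r → ℤ
        upper w = (+ q * μ - D * K) * collisions (slice A w) - μ * (K * K) + D * threeAPs (slice A w)
        lower w = + q * collisions (slice A w) - K * K + δᵥ w 0ᵥ * Z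

        lower≡upper-zero : ∀ w → w ≐ 0ᵥ → lower w ≡ upper w
        lower≡upper-zero w w≐0 = begin
          + q * collisions (slice A w) - K * K + δᵥ w 0ᵥ * Z
            ≡⟨ cong₂ (λ s d → + q * s - K * K + d * Z) (collisions-zero A w w≐0) (cong 𝟙 (dec-true (w ≐? 0ᵥ) w≐0)) ⟩
          + q * (K * K) - K * K + 1ℤ * Z
            ≡⟨ balance (+ q) μ D K ⟩
          (+ q * μ - D * K) * (K * K) - μ * (K * K) + D * (K * K * K)
            ≡⟨ cong₂ (λ s t → (+ q * μ - D * K) * s - μ * (K * K) + D * t) (collisions-zero A w w≐0) (threeAPs-zero A w w≐0) ⟨
          upper w
            ∎
          where
          open ≡-Reasoning
          balance : ∀ Q μ D K → Q * (K * K) - K * K + 1ℤ * ((Q - 1ℤ) * (μ - 1ℤ) * (K * K))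
                               ≡ (Q * μ - D * K) * (K * K) - μ * (K * K) + D * (K * K * K)
          balance = solve-∀

        lower≤upper-nonzero : ∀ w → ¬ w ≐ 0ᵥ → SparseSlices w → lower w ℤ.≤ upper w
        lower≤upper-nonzero w w≢0 sparse = begin
          + q * collisions (slice A w) - K * K + δᵥ w 0ᵥ * Z
            ≡⟨ cong (λ d → + q * collisions (slice A w) - K * K + d * Z) (cong 𝟙 (dec-false (w ≐? 0ᵥ) w≢0)) ⟩
          + q * collisions (slice A w) - K * K + 0ℤ * Z
            ≡⟨ ℤ.+-identityʳ _ ⟩
          + q * collisions (slice A w) - K * K
            ≤⟨ subst (λ k → + q * collisions (slice A w) - k * k
                            ℤ.≤ (+ q * μ - D * k) * collisions (slice A w) - μ * (k * k) + D * threeAPs (slice A w))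
                     (∑-slice₁ A w)
                     (weighted-bound 1+1≢0 (slice A w) μ D λ t → i<j⇒1≤j-i (sparse w≢0 t)) ⟩
          upper w
            ∎
          where open ℤ.≤-Reasoning

        lower≤upper : ∀ w → SparseSlices w → lower w ℤ.≤ upper w
        lower≤upper w sparse = case w ≐? 0ᵥ of λ where
          (yes w≐0) → ℤ.≤-reflexive (lower≡upper-zero w w≐0)
          (no w≢0) → lower≤upper-nonzero w w≢0 sparse

        ΣS ΣT : ℤ
        ΣS = ∑[ w ← vectors r ] collisions (slice A w)
        ΣT = ∑[ w ← vectors r ] threeAPs (slice A w)

        ∑-lower : ∑ (vectors r) lower ≡ + q * ΣS - N r * (K * K) + Z
        ∑-lower = begin
          ∑[ w ← vectors r ] (+ q * collisions (slice A w) - K * K + δᵥ w 0ᵥ * Z)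
            ≡⟨ ∑-+ (vectors r) _ _ ⟩
          ∑[ w ← vectors r ] (+ q * collisions (slice A w) - K * K) + ∑[ w ← vectors r ] (δᵥ w 0ᵥ * Z)
            ≡⟨ cong₂ _+_ (trans (∑-- (vectors r) _ _)
                                (cong₂ _-_ (∑-*ˡ (vectors r) (+ q) (λ w → collisions (slice A w))) (∑ᵥ-const r (K * K))))
                         (trans (∑-*ʳ (vectors r) Z (λ w → δᵥ w 0ᵥ)) (trans (cong (_* Z) (∑-δᵥ r 0ᵥ)) (ℤ.*-identityˡ Z))) ⟩
          + q * ΣS - N r * (K * K) + Z
            ∎
          where open ≡-Reasoning

        ∑-upper : ∑ (vectors r) upper ≡ (+ q * μ - D * K) * ΣS - N r * (μ * (K * K)) + D * ΣT
        ∑-upper = begin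
          ∑[ w ← vectors r ] ((+ q * μ - D * K) * collisions (slice A w) - μ * (K * K) + D * threeAPs (slice A w))
            ≡⟨ ∑-+ (vectors r) _ _ ⟩
          ∑[ w ← vectors r ] ((+ q * μ - D * K) * collisions (slice A w) - μ * (K * K))
            + ∑[ w ← vectors r ] (D * threeAPs (slice A w))
            ≡⟨ cong₂ _+_ (trans (∑-- (vectors r) _ _)
                                (cong₂ _-_ (∑-*ˡ (vectors r) (+ q * μ - D * K) (λ w → collisions (slice A w)))
                                           (∑ᵥ-const r (μ * (K * K)))))
                         (∑-*ˡ (vectors r) D (λ w → threeAPs (slice A w))) ⟩
          (+ q * μ - D * K) * ΣS - N r * (μ * (K * K)) + D * ΣT
            ∎
          where open ≡-Reasoning

        q∑upper : + q * ∑ (vectors r) upper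
          ≡ (+ q * μ - D * K) * (N r * (K * K) + M r * K) - + q * (N r * (μ * (K * K))) + D * (N r * (K * K * K) + M r * K)
        q∑upper = begin
          + q * ∑ (vectors r) upper
            ≡⟨ cong (+ q *_) ∑-upper ⟩
          + q * ((+ q * μ - D * K) * ΣS - N r * (μ * (K * K)) + D * ΣT)
            ≡⟨ distribute (+ q) (+ q * μ - D * K) ΣS (N r * (μ * (K * K))) D ΣT ⟩
          (+ q * μ - D * K) * (+ q * ΣS) - + q * (N r * (μ * (K * K))) + D * (+ q * ΣT)
            ≡⟨ cong₂ (λ s t → (+ q * μ - D * K) * s - + q * (N r * (μ * (K * K))) + D * t)
                     (∑-collisions A) (∑-threeAPs A 1+1≢0 A-pf) ⟩
          (+ q * μ - D * K) * (N r * (K * K) + M r * K) - + q * (N r * (μ * (K * K))) + D * (N r * (K * K * K) + M r * K)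
            ∎
          where
          open ≡-Reasoning
          distribute : ∀ Q α S n D T → Q * (α * S - n + D * T) ≡ α * (Q * S) - Q * n + D * (Q * T)
          distribute = solve-∀

        q∑lower : + q * ∑ (vectors r) lower ≡ + q * (N r * (K * K) + M r * K) - + q * (N r * (K * K)) + + q * Z
        q∑lower = begin
          + q * ∑ (vectors r) lower                                     ≡⟨ cong (+ q *_) ∑-lower ⟩
          + q * (+ q * ΣS - N r * (K * K) + Z)                          ≡⟨ distribute (+ q) (+ q * ΣS) (N r * (K * K)) Z ⟩
          + q * (+ q * ΣS) - + q * (N r * (K * K)) + + q * Z            ≡⟨ cong (λ s → + q * s - + q * (N r * (K * K)) + + q * Z) (∑-collisions A) ⟩
          + q * (N r * (K * K) + M r * K) - + q * (N r * (K * K)) + + q * Z ∎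
          where
          open ≡-Reasoning
          distribute : ∀ Q a b c → Q * (a - b + c) ≡ Q * a - Q * b + Q * c
          distribute = solve-∀

        upper-lower : + q * ∑ (vectors r) upper - + q * ∑ (vectors r) lower ≡ - (+ q * (+ q - 1ℤ) * K * (N r - K))
        upper-lower = trans (cong₂ _-_ q∑upper q∑lower) (trans (cong expression (cong (_- N r) (N-suc r))) (collapse (+ q) (N r) K))
          where
          expression : ℤ → ℤ
          expression m = (+ q * μ - D * K) * (N r * (K * K) + m * K) - + q * (N r * (μ * (K * K))) + D * (N r * (K * K * K) + m * K)
                         - (+ q * (N r * (K * K) + m * K) - + q * (N r * (K * K)) + + q * Z)
          collapse : ∀ Q n K → let μ = n * (K - 1ℤ); D = Q * (n - K); Z = (Q - 1ℤ) * (μ - 1ℤ) * (K * K) in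
            (Q * μ - D * K) * (n * (K * K) + (Q * n - n) * K) - Q * (n * (μ * (K * K)))
              + D * (n * (K * K * K) + (Q * n - n) * K)
              - (Q * (n * (K * K) + (Q * n - n) * K) - Q * (n * (K * K)) + Q * Z)
            ≡ - (Q * (Q - 1ℤ) * K * (n - K))
          collapse = solve-∀

      sparse-impossible : 1ℤ ℤ.< + q → 0ℤ ℤ.< # A → # A ℤ.< N r → ¬ All SparseSlices (vectors r)
      sparse-impossible 1<q 0<K K<N sparse = ℤ.<⇒≱ negative nonnegative
        where
        nonnegative : 0ℤ ℤ.≤ - (+ q * (+ q - 1ℤ) * K * (N r - K))
        nonnegative = subst (0ℤ ℤ.≤_) upper-lower (ℤ.i≤j⇒0≤j-i
          (ℤ.*-monoˡ-≤-nonNeg (+ q) (∑-mono-All (vectors r) (All.map (λ {w} → lower≤upper w) sparse))))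
        negative : - (+ q * (+ q - 1ℤ) * K * (N r - K)) ℤ.< 0ℤ
        negative = ℤ.neg-mono-< (*-pos (*-pos (*-pos (ℤ.<-trans (+<+ (s≤s z≤n)) 1<q) (i<j⇒0<j-i 1<q)) 0<K) (i<j⇒0<j-i K<N))

  -- Hyperplanes

  kernel : ∀ {r} → Vect F r → Subset F r
  kernel w x = does (w · x ≟ 0#)

  kernel⁺ : ∀ {r} (w x : Vect F r) → w · x ≡ 0# → kernel w x ≡ true
  kernel⁺ w x = dec-true (w · x ≟ 0#)

  kernel⁻ : ∀ {r} (w x : Vect F r) → kernel w x ≡ true → w · x ≡ 0#
  kernel⁻ w x x∈ker = invert (subst (Reflects _) x∈ker (proof (w · x ≟ 0#)))

  kernel-isSubspace : ∀ {r} (w : Vect F r) → IsSubspace F (kernel w)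
  kernel-isSubspace w = record
    { zero∈ = kernel⁺ w 0ᵥ (·-zeroʳ w 0ᵥ λ _ → refl)
    ; +-closed = λ u v u∈ v∈ → kernel⁺ w (u ⊕ v)
        (trans (·-⊕ʳ w u v) (trans (cong₂ _+F_ (kernel⁻ w u u∈) (kernel⁻ w v v∈)) (R.+-identityʳ 0#)))
    ; ⊙-closed = λ c v v∈ → kernel⁺ w (c ⊙ v) (trans (·-⊙ʳ w c v) (trans (cong (c *F_) (kernel⁻ w v v∈)) (R.zeroʳ c)))
    }

  unit : ∀ {n} → Fin n → Vect F n
  unit zero zero = 1#
  unit zero (suc _) = 0#
  unit (suc _) zero = 0#
  unit (suc i) (suc j) = unit i j

  private
    0*x+y≡y : ∀ x y → x *F 0# +F y ≡ y
    0*x+y≡y x y = trans (cong (_+F y) (R.zeroʳ x)) (R.+-identityˡ y)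

    x*1+0≡x : ∀ x y → y ≡ 0# → x *F 1# +F y ≡ x
    x*1+0≡x x y y≡0 = trans (cong₂ _+F_ (R.*-identityʳ x) y≡0) (R.+-identityʳ x)

    sumF-*0 : ∀ {n} (c : Fin n → Carrier) → sumF F (λ j → c j *F 0#) ≡ 0#
    sumF-*0 c = sumF-zero _ (λ j → R.zeroʳ (c j))

  sumF-unitˡ : ∀ {n} (c : Fin n → Carrier) i → sumF F (λ j → c j *F unit j i) ≡ c i
  sumF-unitˡ {suc n} c zero = x*1+0≡x (c zero) _ (sumF-*0 (c ∘ suc))
  sumF-unitˡ {suc n} c (suc i) = trans (0*x+y≡y (c zero) _) (sumF-unitˡ (c ∘ suc) i)

  sumF-unitʳ : ∀ {n} (c : Fin n → Carrier) i → sumF F (λ j → c j *F unit i j) ≡ c i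
  sumF-unitʳ {suc n} c zero = x*1+0≡x (c zero) _ (sumF-*0 (c ∘ suc))
  sumF-unitʳ {suc n} c (suc i) = trans (0*x+y≡y (c zero) _) (sumF-unitʳ (c ∘ suc) i)

  private
    nonzero-tail : ∀ {n} (w : Vect F (suc n)) → head w ≡ 0# → ¬ w ≐ 0ᵥ → ¬ tail w ≐ 0ᵥ
    nonzero-tail w w₀≡0 w≢0 w′≐0 = w≢0 λ { zero → w₀≡0 ; (suc i) → w′≐0 i }

    ·-head-zero : ∀ {n} (w v : Vect F (suc n)) → head w ≡ 0# → w · v ≡ tail w · tail v
    ·-head-zero w v w₀≡0 = trans (cong (λ x → x *F head v +F tail w · tail v) w₀≡0)
                                 (trans (cong (_+F tail w · tail v) (R.zeroˡ (head v))) (R.+-identityˡ _))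

    x*[y*x⁻¹]≡y : ∀ x y (x≢0 : x ≢ 0#) → x *F (y *F inv x x≢0) ≡ y
    x*[y*x⁻¹]≡y x y x≢0 = trans (*S.x∙yz≈y∙xz x y _) (trans (cong (y *F_) (*-inverseʳ x x≢0)) (R.*-identityʳ y))

  module _ {n} (w : Vect F (suc n)) (w₀≢0 : head w ≢ 0#) where

    private
      w₀⁻¹ : Carrier
      w₀⁻¹ = inv (head w) w₀≢0

    pivot-basis : Fin n → Vect F (suc n)
    pivot-basis j = -F (w (suc j) *F w₀⁻¹) ∷ᵥ unit j

    pivot-basis-isBasis : IsBasis F (kernel w) pivot-basis
    pivot-basis-isBasis = record
      { in-V = λ j → kernel⁺ w (pivot-basis j) (in-kernel j)
      ; independent = λ c c·b≐0 j → trans (sym (sumF-unitˡ c j)) (c·b≐0 (suc j))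
      ; spanning = λ v v∈ → tail v , spans v (kernel⁻ w v v∈)
      }
      where
      open ≡-Reasoning
      in-kernel : ∀ j → w · pivot-basis j ≡ 0#
      in-kernel j = begin
        head w *F -F (w (suc j) *F w₀⁻¹) +F sumF F (λ i → w (suc i) *F unit j i)
          ≡⟨ cong₂ _+F_ (sym (RP.-‿distribʳ-* (head w) _)) (sumF-unitʳ (tail w) j) ⟩
        -F (head w *F (w (suc j) *F w₀⁻¹)) +F w (suc j)
          ≡⟨ cong (λ x → -F x +F w (suc j)) (x*[y*x⁻¹]≡y (head w) (w (suc j)) w₀≢0) ⟩
        -F w (suc j) +F w (suc j)
          ≡⟨ R.-‿inverseˡ (w (suc j)) ⟩
        0#
          ∎
      spans : ∀ v → w · v ≡ 0# → v ≐ linComb F (tail v) pivot-basis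
      spans v w·v≡0 zero = sym (begin
        sumF F (λ j → v (suc j) *F -F (w (suc j) *F w₀⁻¹))
          ≡⟨ sumF-cong (λ j → trans (sym (RP.-‿distribʳ-* (v (suc j)) _)) (cong -F_ (*S.x∙yz≈z∙yx (v (suc j)) (w (suc j)) w₀⁻¹))) ⟩
        sumF F (λ j → -F (w₀⁻¹ *F (w (suc j) *F v (suc j))))
          ≡⟨ trans (sumF-neg (λ j → w₀⁻¹ *F (w (suc j) *F v (suc j)))) (cong -F_ (sumF-*ˡ w₀⁻¹ (λ j → w (suc j) *F v (suc j)))) ⟩
        -F (w₀⁻¹ *F tail w · tail v)
          ≡⟨ cong (λ s → -F (w₀⁻¹ *F s)) (+G.inverseʳ-unique (head w *F head v) _ w·v≡0) ⟩
        -F (w₀⁻¹ *F -F (head w *F head v))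
          ≡⟨ trans (cong -F_ (sym (RP.-‿distribʳ-* w₀⁻¹ _))) (+G.⁻¹-involutive _) ⟩
        w₀⁻¹ *F (head w *F head v)
          ≡⟨ trans (sym (R.*-assoc w₀⁻¹ (head w) (head v))) (cong (_*F head v) (*-inverseˡ (head w) w₀≢0)) ⟩
        1# *F head v
          ≡⟨ R.*-identityˡ (head v) ⟩
        v zero
          ∎)
      spans v w·v≡0 (suc i) = sym (sumF-unitˡ (tail v) i)

  module _ {n} (w : Vect F (suc (suc n))) (w₀≡0 : head w ≡ 0#)
           (b : Fin n → Vect F (suc n)) (b-basis : IsBasis F (kernel (tail w)) b) where

    extended-basis : Fin (suc n) → Vect F (suc (suc n))
    extended-basis zero = unit zero
    extended-basis (suc j) = 0# ∷ᵥ b j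

    extended-basis-isBasis : IsBasis F (kernel w) extended-basis
    extended-basis-isBasis = record
      { in-V = λ where
          zero → kernel⁺ w (unit zero) (trans (x*1+0≡x (head w) _ (sumF-*0 (tail w))) w₀≡0)
          (suc j) → kernel⁺ w (0# ∷ᵥ b j)
            (trans (·-head-zero w (0# ∷ᵥ b j) w₀≡0) (kernel⁻ (tail w) (b j) (IsBasis.in-V b-basis j)))
      ; independent = λ where
          c c·b≐0 zero → trans (sym (x*1+0≡x (c zero) _ (sumF-*0 (c ∘ suc)))) (c·b≐0 zero)
          c c·b≐0 (suc j) → IsBasis.independent b-basis (c ∘ suc)
            (λ i → trans (sym (0*x+y≡y (c zero) _)) (c·b≐0 (suc i))) j
      ; spanning = λ v v∈ →
          let (c , tail-v≐) = IsBasis.spanning b-basis (tail v)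
                (kernel⁺ (tail w) (tail v) (trans (sym (·-head-zero w v w₀≡0)) (kernel⁻ w v v∈)))
          in head v ∷ᵥ c , λ where
            zero → sym (x*1+0≡x (head v) _ (sumF-*0 c))
            (suc i) → trans (tail-v≐ i) (sym (0*x+y≡y (head v) _))
      }

  kernel-basis : ∀ n (w : Vect F (suc n)) → ¬ w ≐ 0ᵥ → Σ[ b ∈ (Fin n → Vect F (suc n)) ] IsBasis F (kernel w) b
  kernel-basis n w w≢0 with head w ≟ 0#
  ... | no w₀≢0 = pivot-basis w w₀≢0 , pivot-basis-isBasis w w₀≢0
  kernel-basis zero w w≢0 | yes w₀≡0 = ⊥-elim (w≢0 λ { zero → w₀≡0 })
  kernel-basis (suc n) w w≢0 | yes w₀≡0 =
    let (b , b-basis) = kernel-basis n (tail w) (nonzero-tail w w₀≡0 w≢0)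
    in extended-basis w w₀≡0 b b-basis , extended-basis-isBasis w w₀≡0 b b-basis

  level-point : ∀ {r} (w : Vect F r) → ¬ w ≐ 0ᵥ → ∀ t → Σ[ g ∈ Vect F r ] w · g ≡ t
  level-point {zero} w w≢0 t = ⊥-elim (w≢0 λ ())
  level-point {suc r} w w≢0 t with head w ≟ 0#
  ... | no w₀≢0 = t *F inv (head w) w₀≢0 ∷ᵥ 0ᵥ ,
    trans (cong₂ _+F_ (x*[y*x⁻¹]≡y (head w) t w₀≢0) (sumF-*0 (tail w))) (R.+-identityʳ t)
  ... | yes w₀≡0 =
    let (g , w′·g≡t) = level-point (tail w) (nonzero-tail w w₀≡0 w≢0) t
    in 0# ∷ᵥ g , trans (·-head-zero w (0# ∷ᵥ g) w₀≡0) w′·g≡t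

  -- Dense cosets of hyperplanes

  HyperplaneIncrement : ∀ r → Subset F r → Set
  HyperplaneIncrement r A = Σ (Vect F r) λ g → Σ (Subset F r) λ V →
    HasDim F V (r ∸ 1) ×
    ((+ (card F V)) ℤ.* ((+ (card F A)) ℤ.- (+ 1))
      ℤ.≤ (+ (card F (_∩[_+_] F A g V))) ℤ.* ((+ (size ^ r)) ℤ.- (+ (card F A))))

  module _ {n : ℕ} (A : Subset F (suc n)) (w : Vect F (suc n)) (w≢0 : ¬ w ≐ 0ᵥ) (t : Carrier) where

    private
      r = suc n
      g : Vect F r
      g = proj₁ (level-point w w≢0 t)

    q*card-kernel : + q * + card F (kernel w) ≡ N r
    q*card-kernel = begin
      + q * + card F (kernel w)                      ≡⟨ cong (+ q *_) (∑-𝟙 (kernel w) (vectors r)) ⟩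
      + q * ∑[ x ← vectors r ] δ (w · x) 0#          ≡⟨ cong (+ q *_) (∑-cong (vectors r) λ x → cong (λ s → δ s 0#) (·-comm w x)) ⟩
      + q * ∑[ x ← vectors r ] δ (x · w) 0#          ≡⟨ kernel-count r w ⟩
      N r + M r * δᵥ w 0ᵥ                            ≡⟨ cong (λ d → N r + M r * d) (cong 𝟙 (dec-false (w ≐? 0ᵥ) w≢0)) ⟩
      N r + M r * 0ℤ                                 ≡⟨ trans (cong (λ s → N r + s) (ℤ.*-zeroʳ (M r))) (ℤ.+-identityʳ (N r)) ⟩
      N r                                            ∎
      where open ≡-Reasoning

    card-coset : + card F (_∩[_+_] F A g (kernel w)) ≡ slice A w t
    card-coset = trans (∑-𝟙 _ (vectors r)) (∑-cong (vectors r) λ x → trans (𝟙-∧ (A x) _) (cong (𝟙 (A x) *_) (on-coset x)))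
      where
      on-coset : ∀ x → δ (w · (x ⊖ g)) 0# ≡ δ (w · x) t
      on-coset x = begin
        δ (w · (x ⊖ g)) 0#       ≡⟨ cong (λ s → δ s 0#) (·-⊖ʳ w x g) ⟩
        δ (w · x -F w · g) 0#    ≡⟨ δ-sub (w · x) (w · g) ⟨
        δ (w · x) (w · g)        ≡⟨ cong (δ (w · x)) (proj₂ (level-point w w≢0 t)) ⟩
        δ (w · x) t              ∎
        where open ≡-Reasoning

    slice-increment : + card F (kernel w) * (# A - 1ℤ) ℤ.≤ slice A w t * (N r - # A) → HyperplaneIncrement r A
    slice-increment increment = g , kernel w , (kernel-isSubspace w , kernel-basis n w w≢0) ,
      subst₂ (λ k a → + card F (kernel w) * (k - 1ℤ) ℤ.≤ a * (N r - k)) (sym (∑-𝟙 A (vectors r))) (sym card-coset) increment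

    dense-increment : 1ℤ ℤ.< + q → μ A ℤ.≤ D A * slice A w t →
      + card F (kernel w) * (# A - 1ℤ) ℤ.≤ slice A w t * (N r - # A)
    dense-increment 1<q dense = ℤ.*-cancelˡ-≤-pos _ _ (+ q) {{ℤ.positive (ℤ.<-trans (+<+ (s≤s z≤n)) 1<q)}}
      (subst₂ ℤ._≤_ (trans (cong (_* (# A - 1ℤ)) (sym q*card-kernel)) (ℤ.*-assoc (+ q) _ _))
                  (reorder (+ q) (N r - # A) (slice A w t)) dense)
      where
      reorder : ∀ a b c → a * b * c ≡ a * (c * b)
      reorder = solve-∀

    empty-increment : # A ℤ.≤ 0ℤ → + card F (kernel w) * (# A - 1ℤ) ℤ.≤ slice A w t * (N r - # A)
    empty-increment #A≤0 = ℤ.≤-trans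
      (ℤ.≤-trans (ℤ.*-monoˡ-≤-nonNeg (+ card F (kernel w)) (ℤ.i≤j⇒i-k≤j 1ℤ #A≤0)) (ℤ.≤-reflexive (ℤ.*-zeroʳ (+ card F (kernel w)))))
      (ℤ.*-monoʳ-≤-nonNeg (N r - # A) {{nonNegative (ℤ.i≤j⇒0≤j-i (#A≤N A))}}
        (∑-nonneg (vectors r) λ x → subst (0ℤ ℤ.≤_) (𝟙-∧ (A x) _) (0≤𝟙 _)))

  progression-free⇒increment : 1# +F 1# ≢ 0# → 1 ℕ.< q → ∀ n (A : Subset F (suc n)) → ProgressionFree F A →
    HyperplaneIncrement (suc n) A
  progression-free⇒increment 1+1≢0 1<q n A A-pf with # A ℤ.≤? 0ℤ
  ... | yes #A≤0 = slice-increment A e₀ e₀≢0 0# (empty-increment A e₀ e₀≢0 0# #A≤0)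
    where
    e₀ : Vect F (suc n)
    e₀ = unit zero
    e₀≢0 : ¬ e₀ ≐ 0ᵥ
    e₀≢0 e₀≐0 = 0≢1 (sym (e₀≐0 zero))
  ... | no #A≰0 with dense-slice-or-sparse A
  ...   | inj₁ (w , t , w≢0 , dense) = slice-increment A w w≢0 t (dense-increment A w w≢0 t (+<+ 1<q) dense)
  ...   | inj₂ sparse = ⊥-elim (sparse-impossible A 1+1≢0 A-pf (+<+ 1<q) (ℤ.≰⇒> #A≰0)
                                 (#A<N A 1+1≢0 A-pf (+<+ (1<m^[1+n] n 1<q))) sparse)

theorem1 : (F : FiniteField) → (p k : ℕ) → Prime p → p ≢ 2 → 1 ≤ k →
    FiniteField.size F ≡ p ^ k →
    (r : ℕ) → 1 ≤ r →
    (A : Subset F r) → ProgressionFree F A →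
    Σ (Vect F r) λ g → Σ (Subset F r) λ V →
      HasDim F V (r ∸ 1) ×
      ((+ (card F V)) ℤ.* ((+ (card F A)) ℤ.- (+ 1))
        ℤ.≤ (+ (card F (_∩[_+_] F A g V))) ℤ.* ((+ (FiniteField.size F ^ r)) ℤ.- (+ (card F A))))
theorem1 F p (suc k) p-prime p≢2 _ q≡p^k (suc n) _ A A-pf =
  progression-free⇒increment F (prime-power-odd⇒1+1≢0 F p (suc k) p-prime p≢2 q≡p^k) 1<q n A A-pf
  where
  1<q : 1 ℕ.< FiniteField.size F
  1<q = subst (1 ℕ.<_) (sym q≡p^k) (1<m^[1+n] k (nonTrivial⇒n>1 p {{prime⇒nonTrivial p-prime}}))
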